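{- For every positive integer $\ell$, letting $k=R(3;\ell)$ be the $\ell$-colour Ramsey number of the triangle, we have $\pi_{\mathrm{ee}}(K_k^{(3)})\geq \frac{\ell-1}{\ell}$. Consequently $\pi_{\mathrm{ee}}(K_k^{(3)})\to 1$ as $k\to\infty$, where $K_k^{(3)}$ denotes the complete $3$-uniform hypergraph on $k$ vertices.
   Context: $R(3;\ell)$ is the least $k$ such that every colouring of the edges of $K_k$ with $\ell$ colours contains a monochromatic triangle. For a $3$-uniform hypergraph $H=(V,E)$ on $n$ vertices and $P,Q\subseteq V\times V$, let $\mathcal K(P,Q)$ be the set of pairs in $P\times Q$ of the form $((x,y),(x,z))$ and $e(P,Q)$ the number of these with $\{x,y,z\}\in E$; $H$ is $(d,\eta)$-ee-dense if $e(P,Q)\geq d|\mathcal K(P,Q)|-\eta n^3$ for all $P,Q\subseteq V\times V$. For a $3$-uniform hypergraph $F$, $\pi_{\mathrm{ee}}(F)$ is the supremum of all $d\in[0,1]$ such that for every $\eta>0$ and $n\in\mathbb N$ there is an $F$-free $(d,\eta)$-ee-dense $3$-uniform hypergraph with at least $n$ vertices.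
   Formalization: In the definition of π_ee, the densities d in the supremum and the parameter η > 0 range over the rationals. -}

module Defs where

open import Data.Nat as ℕ using (ℕ; zero; suc; _∸_; _^_)
open import Data.Fin using (Fin; zero; suc)
open import Data.Bool using (Bool; true; false; _∧_; if_then_else_)
open import Data.Integer using (+_)
open import Data.Rational using (ℚ; _/_; _+_; _*_; _≤_; _<_; 0ℚ; 1ℚ)
open import Data.Product using (Σ; _×_; ∃)
open import Relation.Binary.PropositionalEquality using (_≡_; _≢_)
open import Function.Definitions using (Injective)

ℕ→ℚ : ℕ → ℚ
ℕ→ℚ n = + n / 1

ΣFin : (n : ℕ) → (Fin n → ℕ) → ℕ
ΣFin zero    f = 0
ΣFin (suc n) f = f zero ℕ.+ ΣFin n (λ i → f (suc i))

[_] : Bool → ℕ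
[ true ]  = 1
[ false ] = 0

record Colouring (ℓ k : ℕ) : Set where
  field
    col : Fin k → Fin k → Fin ℓ
    sym : ∀ i j → i ≢ j → col i j ≡ col j i

MonoTriangle : ∀ {ℓ k} → Colouring ℓ k → Set
MonoTriangle {ℓ} {k} c = Σ (Fin k) λ a → Σ (Fin k) λ b → Σ (Fin k) λ d →
  a ≢ b × a ≢ d × b ≢ d ×
  Colouring.col c a b ≡ Colouring.col c a d × Colouring.col c a b ≡ Colouring.col c b d

Arrows : ℕ → ℕ → Set
Arrows ℓ k = (c : Colouring ℓ k) → MonoTriangle c

IsR3 : ℕ → ℕ → Set
IsR3 ℓ k = Arrows ℓ k × (∀ m → Arrows ℓ m → k ℕ.≤ m)

record Hypergraph3 (n : ℕ) : Set where
  field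
    edge     : Fin n → Fin n → Fin n → Bool
    -- edges are 3-element sets: symmetric under permutations, distinct vertices
    sym₁₂    : ∀ x y z → edge x y z ≡ edge y x z
    sym₂₃    : ∀ x y z → edge x y z ≡ edge x z y
    distinct : ∀ x y z → edge x y z ≡ true → x ≢ y × x ≢ z × y ≢ z

Rel : ℕ → Set
Rel n = Fin n → Fin n → Bool

-- |K(P,Q)| : pairs ((x,y),(x,z)) with (x,y) ∈ P, (x,z) ∈ Q
sizeK : ∀ {n} → Rel n → Rel n → ℕ
sizeK {n} P Q = ΣFin n λ x → ΣFin n λ y → ΣFin n λ z → [ P x y ∧ Q x z ]

ePQ : ∀ {n} → Hypergraph3 n → Rel n → Rel n → ℕ
ePQ {n} H P Q = ΣFin n λ x → ΣFin n λ y → ΣFin n λ z →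
  [ P x y ∧ Q x z ∧ Hypergraph3.edge H x y z ]

-- (d,η)-ee-dense:  e(P,Q) ≥ d |K(P,Q)| − η n³  (rearranged without subtraction)
EEDense : ∀ {n} → ℚ → ℚ → Hypergraph3 n → Set
EEDense {n} d η H = ∀ (P Q : Rel n) →
  d * ℕ→ℚ (sizeK P Q) ≤ ℕ→ℚ (ePQ H P Q) + η * ℕ→ℚ (n ^ 3)

CliqueFree : ∀ {n} → ℕ → Hypergraph3 n → Set
CliqueFree {n} k H = (f : Fin k → Fin n) → Injective _≡_ _≡_ f →
  (∀ i j l → i ≢ j → i ≢ l → j ≢ l → Hypergraph3.edge H (f i) (f j) (f l) ≡ true) →
  Data.Empty.⊥
  where import Data.Empty

-- d is "admissible" for K_k^(3): for every η > 0 and every N there is a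
-- K_k^(3)-free (d,η)-ee-dense hypergraph on at least N vertices.
-- π_ee(K_k^(3)) is the supremum of admissible d ∈ [0,1].
AdmissibleEE : ℕ → ℚ → Set
AdmissibleEE k d = ∀ (η : ℚ) → 0ℚ < η → ∀ (N : ℕ) →
  Σ ℕ λ n → N ℕ.≤ n × Σ (Hypergraph3 n) λ H → CliqueFree k H × EEDense d η H

-- π_ee(K_k^(3)) ≥ c  ⇔  every rational d ∈ [0,1] with d < c is admissible
-- (admissibility is downward closed in d, so this is equivalent to sup ≥ c)
πee≥ : ℕ → ℚ → Set
πee≥ k c = ∀ (d : ℚ) → 0ℚ ≤ d → d ≤ 1ℚ → d < c → AdmissibleEE k d

module Submission where

-- Take q = ℓ + 1 colours and, as vertices, t-tuples x = (x₁,…,xₜ) of blocks xᵢ ∈ 𝔽₂^m, so n = 2^(mt).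
-- A pair has the signature σ(x,y) = (⟨x₁,y₁⟩,…,⟨xₜ,yₜ⟩) ∈ 𝔽₂^t and the colour σ(x,y), read as a binary
-- number, modulo q; a triple is an edge iff its three pairs are not all of one colour. A copy of K_k^(3) is then
-- a q-colouring of K_k without monochromatic triangle, which k = R(3;q) rules out.
-- For the density, fix x and split the y with (x,y) ∈ P and the z with (x,z) ∈ Q by the colour γ of their pair
-- with x: among distinct x, y, z a non-edge forces colour(y,z) = γ as well. For a character u ≠ 0 of 𝔽₂^t the sum
-- of (-1)^⟨u,σ(y,z)⟩ over any A × B has modulus at most n²/√(2^m), by Cauchy–Schwarz and the orthogonality of the
-- characters of 𝔽₂^m in a block with uᵢ = 1. By Fourier inversion σ is then almost uniform on A × B, and a residue
-- class mod q contains at most 2^t/q + 1 signatures, so a colour class covers at most (1/q + 2^-t)|A||B| pairs up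
-- to an error O(2^t n²/√(2^m)). Summed over γ and x, at most a (1/q + 2^-t)-fraction of K(P,Q) are non-edges, up
-- to O(n³/√(2^m)); taking t and then m large gives every density d < ℓ/(ℓ+1).

open import Algebra.Bundles using (CommutativeSemiring; CommutativeMonoid)
open import Data.Bool.Base using (Bool; true; false; _∧_; _xor_; not)
import Data.Bool.Properties as Boolₚ
open import Data.Empty using (⊥; ⊥-elim)
open import Data.Fin.Base
  using (Fin; zero; suc; toℕ; _↑ˡ_; _↑ʳ_; remQuot; remainder; finToFun; funToFin; combine; inject≤; punchOut; punchIn)
open import Data.Fin.Properties as Finₚ using (2↔Bool)
open import Data.Integer.Base as ℤ using (ℤ; +_; ∣_∣; +≤+; -≤+; -[1+_])
import Data.Integer.Properties as ℤP
open import Data.Integer.Tactic.RingSolver using () renaming (solve-∀ to ℤ-solve)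
open import Data.List.Base using (List; []; _∷_; length; filter; allFin)
import Data.List.Properties as Listₚ
open import Data.List.Membership.Propositional using (_∈_)
import Data.List.Membership.Propositional.Properties as Membershipₚ
open import Data.List.Relation.Unary.All using (All; []; _∷_)
open import Data.List.Relation.Unary.Any using (here; there)
open import Data.List.Relation.Unary.Unique.Propositional using (Unique; []; _∷_)
import Data.List.Relation.Unary.Unique.Propositional.Properties as Uniqueₚ
open import Data.Nat.Base as ℕ using (ℕ; zero; suc; z≤n; s≤s; NonZero; _^_; _≥_)
import Data.Nat.Coprimality as Coprimality
open import Data.Nat.DivMod as DivMod using (_mod_; _%_)
import Data.Nat.Properties as ℕP
open import Data.Nat.Tactic.RingSolver using () renaming (solve-∀ to ℕ-solve)
open import Data.Product.Base using (Σ; ∃; _×_; _,_; proj₁; proj₂; uncurry; map₁)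
open import Data.Rational.Base as ℚ using (ℚ; mkℚ; toℚᵘ; _/_; _<_; 0ℚ; 1ℚ; NonNegative; Positive)
import Data.Rational.Properties as ℚP
open import Data.Rational.Solver using (module +-*-Solver)
open import Data.Rational.Unnormalised.Base as ℚᵘ using (mkℚᵘ; *≡*; *≤*)
import Data.Rational.Unnormalised.Properties as ℚᵘP
open import Data.Vec.Functional using (removeAt)
open import Function.Base using (_∘_)
open import Function.Bundles using (Inverse)
open import Relation.Binary.Definitions using (DecidableEquality)
open import Relation.Binary.PropositionalEquality
  using (_≡_; _≢_; _≗_; refl; sym; trans; cong; cong₂; subst; subst₂; module ≡-Reasoning)
open import Relation.Nullary.Decidable using (Dec; yes; no; does; dec-true; dec-false)
open import Relation.Nullary.Negation using (contradiction)

open import Defs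

module FinSumProperties {c ℓ} (S : CommutativeSemiring c ℓ) where

  open CommutativeSemiring S hiding (zero) renaming (refl to ≈-refl; sym to ≈-sym; trans to ≈-trans)
  open import Algebra.Properties.Semiring.Sum semiring public
  open import Algebra.Properties.CommutativeMonoid.Sum *-commutativeMonoid public
    using ()
    renaming (sum to product; ∑-distrib-+ to product-distrib-*; sum-cong-≗ to product-cong-≗;
              sum-remove to product-remove)
  open import Relation.Binary.Reasoning.Setoid setoid

  infixl 10 product-syntax
  product-syntax : ∀ n → (Fin n → Carrier) → Carrier
  product-syntax _ = product
  syntax product-syntax n (λ i → x) = ∏[ i < n ] x

  sum-↑ : ∀ a b (f : Fin (a ℕ.+ b) → Carrier) → sum f ≈ ∑[ i < a ] f (i ↑ˡ b) + ∑[ j < b ] f (a ↑ʳ j)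
  sum-↑ zero    b f = ≈-sym (+-identityˡ _)
  sum-↑ (suc a) b f = ≈-trans (+-congˡ (sum-↑ a b (λ i → f (suc i)))) (≈-sym (+-assoc _ _ _))

  sum-remQuot : ∀ m n (g : Fin m → Fin n → Carrier) →
                ∑[ x < m ℕ.* n ] uncurry g (remQuot n x) ≈ ∑[ a < m ] ∑[ b < n ] g a b
  sum-remQuot zero    n g = ≈-refl
  sum-remQuot (suc m) n g = begin
    ∑[ x < n ℕ.+ m ℕ.* n ] uncurry g (remQuot n x)
      ≈⟨ sum-↑ n (m ℕ.* n) _ ⟩
    ∑[ b < n ] uncurry g (remQuot n (b ↑ˡ m ℕ.* n)) + ∑[ x < m ℕ.* n ] uncurry g (remQuot n (n ↑ʳ x))
      ≡⟨ cong₂ _+_ (sum-cong-≗ λ b → cong (uncurry g) (Finₚ.remQuot-combine zero b))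
                   (sum-cong-≗ λ x → cong (uncurry g) (remQuot-↑ʳ x)) ⟩
    ∑[ b < n ] g zero b + ∑[ x < m ℕ.* n ] uncurry (λ a → g (suc a)) (remQuot n x)
      ≈⟨ +-congˡ (sum-remQuot m n (λ a → g (suc a))) ⟩
    ∑[ b < n ] g zero b + ∑[ a < m ] ∑[ b < n ] g (suc a) b ∎
    where
    remQuot-↑ʳ : ∀ x → remQuot {suc m} n (n ↑ʳ x) ≡ map₁ suc (remQuot {m} n x)
    remQuot-↑ʳ x rewrite Finₚ.splitAt-↑ʳ n (m ℕ.* n) x = refl

  ∑-∏-finToFun : ∀ {k} t (f : Fin t → Fin k → Carrier) →
                 ∑[ x < k ^ t ] ∏[ i < t ] f i (finToFun x i) ≈ ∏[ i < t ] ∑[ a < k ] f i a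
  ∑-∏-finToFun         zero    f = +-identityʳ 1#
  ∑-∏-finToFun {k} (suc t) f = begin
    ∑[ x < k ℕ.* k ^ t ] uncurry g (remQuot (k ^ t) x)
      ≈⟨ sum-remQuot k (k ^ t) g ⟩
    ∑[ a < k ] ∑[ y < k ^ t ] (f zero a * P y)
      ≈⟨ sum-cong-≋ (λ a → ≈-sym (*-distribˡ-sum (f zero a) P)) ⟩
    ∑[ a < k ] (f zero a * sum P)
      ≈⟨ ≈-sym (*-distribʳ-sum (sum P) (f zero)) ⟩
    sum (f zero) * sum P
      ≈⟨ *-congˡ (∑-∏-finToFun t (λ i → f (suc i))) ⟩
    sum (f zero) * ∏[ i < t ] sum (f (suc i)) ∎
    where
    P : Fin (k ^ t) → Carrier
    P y = ∏[ i < t ] f (suc i) (finToFun y i)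
    g : Fin k → Fin (k ^ t) → Carrier
    g a y = f zero a * P y

  product-zero : ∀ {n} (f : Fin n → Carrier) i → f i ≈ 0# → product f ≈ 0#
  product-zero {suc n} f i fi≈0 = begin
    product f                      ≈⟨ product-remove {i = i} f ⟩
    f i * product (removeAt f i)   ≈⟨ *-congʳ fi≈0 ⟩
    0# * product (removeAt f i)    ≈⟨ zeroˡ _ ⟩
    0#                             ∎

  ∑∑-* : ∀ {m n} (p : Fin m → Carrier) (q : Fin n → Carrier) → ∑[ i < m ] ∑[ j < n ] (p i * q j) ≈ sum p * sum q
  ∑∑-* p q = ≈-trans (sum-cong-≋ λ i → ≈-sym (*-distribˡ-sum (p i) q)) (≈-sym (*-distribʳ-sum (sum q) p))

  ∑∑-distrib-+ : ∀ {m n} (f g : Fin m → Fin n → Carrier) →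
    ∑[ i < m ] ∑[ j < n ] (f i j + g i j) ≈ ∑[ i < m ] ∑[ j < n ] f i j + ∑[ i < m ] ∑[ j < n ] g i j
  ∑∑-distrib-+ f g = ≈-trans (sum-cong-≋ λ i → ∑-distrib-+ (f i) (g i)) (∑-distrib-+ (λ i → sum (f i)) (λ i → sum (g i)))

does-≟-comm : ∀ {k} (a b : Fin k) → does (a Finₚ.≟ b) ≡ does (b Finₚ.≟ a)
does-≟-comm a b with a Finₚ.≟ b | b Finₚ.≟ a
... | yes _   | yes _   = refl
... | no  _   | no  _   = refl
... | yes a≡b | no  b≢a = contradiction (sym a≡b) b≢a
... | no  a≢b | yes b≡a = contradiction (sym b≡a) a≢b

funToFin-cong : ∀ {m n} {f g : Fin m → Fin n} → f ≗ g → funToFin f ≡ funToFin g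
funToFin-cong {zero}  _   = refl
funToFin-cong {suc m} f≗g = cong₂ combine (f≗g zero) (funToFin-cong (f≗g ∘ suc))

[∧] : ∀ p q → [ p ∧ q ] ≡ [ p ] ℕ.* [ q ]
[∧] true  q = sym (ℕP.+-identityʳ [ q ])
[∧] false q = refl

[∧∧] : ∀ p q r → [ p ∧ q ∧ r ] ≡ [ p ∧ q ] ℕ.* [ r ]
[∧∧] true  true  r = sym (ℕP.+-identityʳ [ r ])
[∧∧] true  false r = refl
[∧∧] false q     r = refl

[∧]-≤ : ∀ p q → [ p ∧ q ] ℕ.≤ [ p ]
[∧]-≤ true  true  = ℕP.≤-refl
[∧]-≤ true  false = z≤n
[∧]-≤ false q     = z≤n

indicator-split : ∀ p r e {S} → (p ≡ true → r ≡ true → e ≡ false → 1 ℕ.≤ S) → [ p ∧ r ] ℕ.≤ [ p ∧ r ∧ e ] ℕ.+ S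
indicator-split false r     e     _ = z≤n
indicator-split true  false e     _ = z≤n
indicator-split true  true  true  _ = s≤s z≤n
indicator-split true  true  false h = h refl refl refl

square-≤-cancel : ∀ a b → a ℕ.* a ℕ.≤ b ℕ.* b → a ℕ.≤ b
square-≤-cancel a b a²≤b² with a ℕP.≤? b
... | yes a≤b = a≤b
... | no  a≰b = contradiction a²≤b² (ℕP.<⇒≱ (ℕP.*-mono-< (ℕP.≰⇒> a≰b) (ℕP.≰⇒> a≰b)))

n≤2^n : ∀ n → n ℕ.≤ 2 ^ n
n≤2^n zero    = z≤n
n≤2^n (suc n) = ℕP.+-mono-≤ (ℕP.m^n>0 2 n) (ℕP.≤-trans (n≤2^n n) (ℕP.m≤m+n (2 ^ n) 0))

module ℕΣ where

  open FinSumProperties ℕP.+-*-commutativeSemiring public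
  open import Data.Nat.Base using (_+_; _*_; _≤_)

  ΣFin≡sum : ∀ n (f : Fin n → ℕ) → ΣFin n f ≡ sum f
  ΣFin≡sum zero    f = refl
  ΣFin≡sum (suc n) f = cong (ℕ._+_ (f zero)) (ΣFin≡sum n (λ i → f (suc i)))

  sum-mono-≤ : ∀ {n} {f g : Fin n → ℕ} → (∀ i → f i ≤ g i) → sum f ≤ sum g
  sum-mono-≤ {zero}  _   = ℕP.≤-refl
  sum-mono-≤ {suc n} f≤g = ℕP.+-mono-≤ (f≤g zero) (sum-mono-≤ (f≤g ∘ suc))

  term-≤-sum : ∀ {n} (f : Fin n → ℕ) i → f i ≤ sum f
  term-≤-sum {suc n} f i = subst (f i ≤_) (sym (sum-remove {i = i} f)) (ℕP.m≤m+n (f i) _)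

  ∑-const : ∀ n c → ∑[ i < n ] c ≡ n * c
  ∑-const zero    c = refl
  ∑-const (suc n) c = cong (ℕ._+_ c) (∑-const n c)

  ∑-δ* : ∀ {k} (a : Fin k) (g : Fin k → ℕ) → ∑[ b < k ] ([ does (a Finₚ.≟ b) ] * g b) ≡ g a
  ∑-δ* {suc k} zero    g = trans (cong (ℕ._+_ (g zero + 0)) (sum-replicate-zero k))
                                 (trans (ℕP.+-identityʳ _) (ℕP.+-identityʳ (g zero)))
  ∑-δ* {suc k} (suc a) g = ∑-δ* a (λ b → g (suc b))

  ∑-δ : ∀ {k} (a : Fin k) → ∑[ b < k ] [ does (a Finₚ.≟ b) ] ≡ 1
  ∑-δ a = trans (sum-cong-≗ λ b → sym (ℕP.*-identityʳ [ does (a Finₚ.≟ b) ])) (∑-δ* a (λ _ → 1))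

  product-const : ∀ k c → ∏[ i < k ] c ≡ c ^ k
  product-const zero    c = refl
  product-const (suc k) c = cong (c *_) (product-const k c)

  product-mono-≤ : ∀ {k} {f g : Fin k → ℕ} → (∀ i → f i ≤ g i) → product f ≤ product g
  product-mono-≤ {zero}  _   = ℕP.≤-refl
  product-mono-≤ {suc k} f≤g = ℕP.*-mono-≤ (f≤g zero) (product-mono-≤ (f≤g ∘ suc))

  *-product-≤ : ∀ {k} (f g : Fin k → ℕ) j c → (∀ i → f i ≤ g i) → c * f j ≤ g j → c * product f ≤ product g
  *-product-≤ {suc k} f g j c f≤g cfj≤gj = begin
    c * product f                         ≡⟨ cong (c *_) (product-remove {i = j} f) ⟩
    c * (f j * product (removeAt f j))    ≡⟨ ℕP.*-assoc c (f j) _ ⟨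
    c * f j * product (removeAt f j)      ≤⟨ ℕP.*-mono-≤ cfj≤gj (product-mono-≤ (λ i → f≤g (punchIn j i))) ⟩
    g j * product (removeAt g j)          ≡⟨ product-remove {i = j} g ⟨
    product g                             ∎
    where open ℕP.≤-Reasoning

  size : ∀ {n} → (Fin n → Bool) → ℕ
  size A = ∑[ x < _ ] [ A x ]

module ℤΣ where

  open FinSumProperties ℤP.+-*-commutativeSemiring public
  open import Data.Integer.Base using (_≤_)

  sum-mono-≤ : ∀ {n} {f g : Fin n → ℤ} → (∀ i → f i ≤ g i) → sum f ≤ sum g
  sum-mono-≤ {zero}  _   = ℤP.≤-refl
  sum-mono-≤ {suc n} f≤g = ℤP.+-mono-≤ (f≤g zero) (sum-mono-≤ (f≤g ∘ suc))

  sum-nonNeg : ∀ {n} {f : Fin n → ℤ} → (∀ i → + 0 ≤ f i) → + 0 ≤ sum f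
  sum-nonNeg {zero}  _   = ℤP.≤-refl
  sum-nonNeg {suc n} 0≤f = ℤP.+-mono-≤ (0≤f zero) (sum-nonNeg (0≤f ∘ suc))

  pos-sum : ∀ {k} (f : Fin k → ℕ) → ∑[ i < k ] (+ f i) ≡ + ℕΣ.sum f
  pos-sum {zero}  f = refl
  pos-sum {suc k} f = trans (cong (ℤ._+_ (+ f zero)) (pos-sum (f ∘ suc))) (sym (ℤP.pos-+ (f zero) _))

  pos-product : ∀ {k} (f : Fin k → ℕ) → ∏[ i < k ] (+ f i) ≡ + ℕΣ.product f
  pos-product {zero}  f = refl
  pos-product {suc k} f = trans (cong (ℤ._*_ (+ f zero)) (pos-product (f ∘ suc))) (sym (ℤP.pos-* (f zero) _))

  ∑-const : ∀ n c → ∑[ i < n ] (+ c) ≡ + (n ℕ.* c)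
  ∑-const n c = trans (pos-sum {n} (λ _ → c)) (cong +_ (ℕΣ.∑-const n c))

  ∑-δ : ∀ {k} (a : Fin k) → ∑[ b < k ] (+ [ does (a Finₚ.≟ b) ]) ≡ + 1
  ∑-δ a = trans (pos-sum (λ b → [ does (a Finₚ.≟ b) ])) (cong +_ (ℕΣ.∑-δ a))

  product-const : ∀ k c → ∏[ i < k ] (+ c) ≡ + (c ^ k)
  product-const k c = trans (pos-product {k} (λ _ → c)) (cong +_ (ℕΣ.product-const k c))

  product-one : ∀ {k} (f : Fin k → ℤ) → (∀ i → f i ≡ + 1) → ∏[ i < k ] f i ≡ + 1
  product-one {k} f f≡1 = trans (product-cong-≗ f≡1) (trans (product-const k 1) (cong +_ (ℕP.^-zeroˡ k)))

module CauchySchwarz where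

  open ℤΣ
  open import Data.Integer.Base using (_+_; _*_; _-_; -_; _≤_)

  square-nonNeg : ∀ i → + 0 ≤ i * i
  square-nonNeg (+ k)    = subst (+ 0 ≤_) (ℤP.pos-* k k) (+≤+ z≤n)
  square-nonNeg -[1+ k ] = +≤+ z≤n

  lagrange-identity : ∀ {n} (x y : Fin n → ℤ) →
    ∑[ i < n ] ∑[ j < n ] ((x i * y j - x j * y i) * (x i * y j - x j * y i))
      ≡ + 2 * (sum (λ i → x i * x i) * sum (λ i → y i * y i) - sum (λ i → x i * y i) * sum (λ i → x i * y i))
  lagrange-identity {n} x y = begin
    ∑[ i < n ] ∑[ j < n ] ((x i * y j - x j * y i) * (x i * y j - x j * y i))
      ≡⟨ sum-cong-≗ (λ i → sum-cong-≗ λ j → expand (x i) (y i) (x j) (y j)) ⟩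
    ∑[ i < n ] ∑[ j < n ] (a i * b j + b i * a j + (- + 2 * c i) * c j)
      ≡⟨ trans (∑∑-distrib-+ (λ i j → a i * b j + b i * a j) (λ i j → (- + 2 * c i) * c j))
               (cong (_+ ∑[ i < n ] ∑[ j < n ] ((- + 2 * c i) * c j)) (∑∑-distrib-+ (λ i j → a i * b j) (λ i j → b i * a j))) ⟩
    ∑[ i < n ] ∑[ j < n ] (a i * b j) + ∑[ i < n ] ∑[ j < n ] (b i * a j) + ∑[ i < n ] ∑[ j < n ] ((- + 2 * c i) * c j)
      ≡⟨ cong₂ _+_ (cong₂ _+_ (∑∑-* a b) (∑∑-* b a))
                   (trans (∑∑-* (λ i → - + 2 * c i) c) (cong (_* sum c) (sym (*-distribˡ-sum (- + 2) c)))) ⟩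
    sum a * sum b + sum b * sum a + (- + 2 * sum c) * sum c
      ≡⟨ collect (sum a) (sum b) (sum c) ⟩
    + 2 * (sum a * sum b - sum c * sum c) ∎
    where
    open ≡-Reasoning
    a = λ i → x i * x i
    b = λ i → y i * y i
    c = λ i → x i * y i
    expand : ∀ xi yi xj yj → (xi * yj - xj * yi) * (xi * yj - xj * yi)
                             ≡ (xi * xi) * (yj * yj) + (yi * yi) * (xj * xj) + (- + 2 * (xi * yi)) * (xj * yj)
    expand = ℤ-solve
    collect : ∀ A B C → A * B + B * A + (- + 2 * C) * C ≡ + 2 * (A * B - C * C)
    collect = ℤ-solve

  cauchy-schwarz : ∀ {n} (x y : Fin n → ℤ) →
    sum (λ i → x i * y i) * sum (λ i → x i * y i) ≤ sum (λ i → x i * x i) * sum (λ i → y i * y i)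
  cauchy-schwarz x y = ℤP.0≤i-j⇒j≤i (ℤP.*-cancelˡ-≤-pos (+ 0) _ (+ 2)
    (subst (+ 0 ≤_) (lagrange-identity x y) (sum-nonNeg λ i → sum-nonNeg λ j → square-nonNeg (x i * y j - x j * y i))))

  ∑-square-expand : ∀ {n k} (f : Fin k → ℤ) (g : Fin n → Fin k → ℤ) →
    ∑[ x < n ] (∑[ y < k ] (f y * g x y) * ∑[ y < k ] (f y * g x y))
      ≡ ∑[ y < k ] ∑[ y′ < k ] ((f y * f y′) * ∑[ x < n ] (g x y * g x y′))
  ∑-square-expand {n} {k} f g = begin
    ∑[ x < n ] (∑[ y < k ] (f y * g x y) * ∑[ y < k ] (f y * g x y))
      ≡⟨ sum-cong-≗ (λ x → sym (∑∑-* (λ y → f y * g x y) (λ y → f y * g x y))) ⟩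
    ∑[ x < n ] ∑[ y < k ] ∑[ y′ < k ] ((f y * g x y) * (f y′ * g x y′))
      ≡⟨ ∑-comm (λ x y → ∑[ y′ < k ] ((f y * g x y) * (f y′ * g x y′))) ⟩
    ∑[ y < k ] ∑[ x < n ] ∑[ y′ < k ] ((f y * g x y) * (f y′ * g x y′))
      ≡⟨ sum-cong-≗ (λ y → ∑-comm (λ x y′ → (f y * g x y) * (f y′ * g x y′))) ⟩
    ∑[ y < k ] ∑[ y′ < k ] ∑[ x < n ] ((f y * g x y) * (f y′ * g x y′))
      ≡⟨ sum-cong-≗ (λ y → sum-cong-≗ λ y′ → trans (sum-cong-≗ λ x → interchange (f y) (g x y) (f y′) (g x y′))
                                                    (sym (*-distribˡ-sum (f y * f y′) (λ x → g x y * g x y′)))) ⟩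
    ∑[ y < k ] ∑[ y′ < k ] ((f y * f y′) * ∑[ x < n ] (g x y * g x y′)) ∎
    where
    open ≡-Reasoning
    interchange : ∀ p q r s → (p * q) * (r * s) ≡ (p * r) * (q * s)
    interchange = ℤ-solve

module Characters where

  open ℤΣ
  open import Data.Integer.Base using (_*_; -_; _≤_)

  sgn : Bool → ℤ
  sgn false = + 1
  sgn true  = - + 1

  sgn-xor : ∀ a b → sgn (a xor b) ≡ sgn a * sgn b
  sgn-xor false b     = sym (ℤP.*-identityˡ (sgn b))
  sgn-xor true  false = refl
  sgn-xor true  true  = refl

  i≤+∣i∣ : ∀ i → i ≤ + ∣ i ∣
  i≤+∣i∣ (+ k)    = ℤP.≤-refl
  i≤+∣i∣ -[1+ k ] = -≤+

  sgn*-≤ : ∀ b i → sgn b * i ≤ + ∣ i ∣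
  sgn*-≤ false i = subst (_≤ + ∣ i ∣) (sym (ℤP.*-identityˡ i)) (i≤+∣i∣ i)
  sgn*-≤ true  i = subst (_≤ + ∣ i ∣) (sym (ℤP.-1*i≡-i i))
                         (subst (λ k → - i ≤ + k) (ℤP.∣-i∣≡∣i∣ i) (i≤+∣i∣ (- i)))

  ∑-sgn-∧-sgn-∧ : ∀ b b′ → ∑[ a < 2 ] (sgn (Inverse.to 2↔Bool a ∧ b) * sgn (Inverse.to 2↔Bool a ∧ b′))
                          ≡ + (2 ℕ.* [ does (b Boolₚ.≟ b′) ])
  ∑-sgn-∧-sgn-∧ false false = refl
  ∑-sgn-∧-sgn-∧ false true  = refl
  ∑-sgn-∧-sgn-∧ true  false = refl
  ∑-sgn-∧-sgn-∧ true  true  = refl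

  -- 𝔽₂^d is encoded as Fin (2 ^ d), with coordinates read off by finToFun; χ u is the character (-1)^⟨u,·⟩.
  module Cube (d : ℕ) where

    bit : Fin (2 ^ d) → Fin d → Bool
    bit x i = Inverse.to 2↔Bool (finToFun x i)

    bit-injective : ∀ {β β′} → (∀ i → bit β i ≡ bit β′ i) → β ≡ β′
    bit-injective {β} {β′} same = begin
      β                                ≡⟨ Finₚ.funToFin-finToFin {d} {2} β ⟨
      funToFin (finToFun {2} {d} β)    ≡⟨ funToFin-cong (λ i → to-injective (same i)) ⟩
      funToFin (finToFun {2} {d} β′)   ≡⟨ Finₚ.funToFin-finToFin {d} {2} β′ ⟩
      β′                               ∎
      where
      open ≡-Reasoning
      open Inverse 2↔Bool using (to; from; strictlyInverseʳ)
      to-injective : ∀ {a b} → to a ≡ to b → a ≡ b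
      to-injective {a} {b} e = trans (sym (strictlyInverseʳ a)) (trans (cong from e) (strictlyInverseʳ b))

    χ : Fin (2 ^ d) → Fin (2 ^ d) → ℤ
    χ u β = ∏[ i < d ] sgn (bit u i ∧ bit β i)

    product-bits-agree : ∀ β β′ →
      ∏[ i < d ] (+ (2 ℕ.* [ does (bit β i Boolₚ.≟ bit β′ i) ])) ≡ + (2 ^ d ℕ.* [ does (β Finₚ.≟ β′) ])
    product-bits-agree β β′ with β Finₚ.≟ β′
    ... | yes refl = trans (product-cong-≗ λ i → cong (λ e → + (2 ℕ.* [ e ])) (dec-true (bit β i Boolₚ.≟ bit β i) refl))
                           (trans (product-const d 2) (cong +_ (sym (ℕP.*-identityʳ (2 ^ d)))))
    ... | no β≢β′ with Finₚ.¬∀⟶∃¬ d _ (λ i → bit β i Boolₚ.≟ bit β′ i) (β≢β′ ∘ bit-injective)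
    ...   | i , differ = trans (product-zero _ i (cong (λ e → + (2 ℕ.* [ e ])) (dec-false (bit β i Boolₚ.≟ bit β′ i) differ)))
                               (cong +_ (sym (ℕP.*-zeroʳ (2 ^ d))))

    character-orthogonality : ∀ β β′ → ∑[ u < 2 ^ d ] (χ u β * χ u β′) ≡ + (2 ^ d ℕ.* [ does (β Finₚ.≟ β′) ])
    character-orthogonality β β′ = begin
      ∑[ u < 2 ^ d ] (χ u β * χ u β′)
        ≡⟨ sum-cong-≗ (λ u → sym (product-distrib-* (λ i → sgn (bit u i ∧ bit β i)) (λ i → sgn (bit u i ∧ bit β′ i)))) ⟩
      ∑[ u < 2 ^ d ] ∏[ i < d ] (sgn (bit u i ∧ bit β i) * sgn (bit u i ∧ bit β′ i))
        ≡⟨ ∑-∏-finToFun d (λ i a → sgn (Inverse.to 2↔Bool a ∧ bit β i) * sgn (Inverse.to 2↔Bool a ∧ bit β′ i)) ⟩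
      ∏[ i < d ] ∑[ a < 2 ] (sgn (Inverse.to 2↔Bool a ∧ bit β i) * sgn (Inverse.to 2↔Bool a ∧ bit β′ i))
        ≡⟨ product-cong-≗ (λ i → ∑-sgn-∧-sgn-∧ (bit β i) (bit β′ i)) ⟩
      ∏[ i < d ] (+ (2 ℕ.* [ does (bit β i Boolₚ.≟ bit β′ i) ]))
        ≡⟨ product-bits-agree β β′ ⟩
      + (2 ^ d ℕ.* [ does (β Finₚ.≟ β′) ]) ∎
      where open ≡-Reasoning

  dot : ∀ d → Fin (2 ^ d) → Fin (2 ^ d) → Bool
  dot zero    a b = false
  dot (suc d) a b = (bit a zero ∧ bit b zero) xor dot d (remainder {2} (2 ^ d) a) (remainder {2} (2 ^ d) b)
    where open Cube (suc d)

  sgn-dot : ∀ d a b → sgn (dot d a b) ≡ Cube.χ d a b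
  sgn-dot zero    a b = refl
  sgn-dot (suc d) a b = trans (sgn-xor (bit a zero ∧ bit b zero) _)
                              (cong (sgn (bit a zero ∧ bit b zero) *_) (sgn-dot d (remainder {2} (2 ^ d) a) (remainder {2} (2 ^ d) b)))
    where open Cube (suc d)

  dot-comm : ∀ d a b → dot d a b ≡ dot d b a
  dot-comm zero    a b = refl
  dot-comm (suc d) a b = cong₂ _xor_ (Boolₚ.∧-comm (bit a zero) (bit b zero))
                                     (dot-comm d (remainder {2} (2 ^ d) a) (remainder {2} (2 ^ d) b))
    where open Cube (suc d)

module BlockVertices (m t : ℕ) where

  open ℤΣ
  open Characters
  open Cube t using (bit; χ)
  open import Data.Integer.Base using (_*_)

  N = 2 ^ m
  n = N ^ t

  block : Fin n → Fin t → Fin N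
  block x = finToFun x

  sig : Fin n → Fin n → Fin (2 ^ t)
  sig x y = funToFin λ i → Inverse.from 2↔Bool (dot m (block x i) (block y i))

  bit-sig : ∀ x y i → bit (sig x y) i ≡ dot m (block x i) (block y i)
  bit-sig x y i = trans (cong to (Finₚ.finToFun-funToFin {t} {2} _ i)) (strictlyInverseˡ _)
    where open Inverse 2↔Bool using (to; strictlyInverseˡ)

  sig-comm : ∀ x y → sig x y ≡ sig y x
  sig-comm x y = funToFin-cong λ i → cong (Inverse.from 2↔Bool) (dot-comm m (block x i) (block y i))

  ψ : Fin (2 ^ t) → Fin n → Fin n → ℤ
  ψ u x y = χ u (sig x y)

  ψ-factorises : ∀ u x y → ψ u x y ≡ ∏[ i < t ] sgn (bit u i ∧ dot m (block x i) (block y i))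
  ψ-factorises u x y = product-cong-≗ λ i → cong (λ b → sgn (bit u i ∧ b)) (bit-sig x y i)

  block-correlation : Bool → Fin N → Fin N → ℕ
  block-correlation false b b′ = N
  block-correlation true  b b′ = N ℕ.* [ does (b Finₚ.≟ b′) ]

  ∑-block : ∀ c b b′ → ∑[ a < N ] (sgn (c ∧ dot m a b) * sgn (c ∧ dot m a b′)) ≡ + block-correlation c b b′
  ∑-block false b b′ = trans (∑-const N 1) (cong +_ (ℕP.*-identityʳ N))
  ∑-block true  b b′ = trans (sum-cong-≗ λ a → cong₂ _*_ (sgn-dot m a b) (sgn-dot m a b′))
                             (Cube.character-orthogonality m b b′)

  ψ-correlation : ∀ u y y′ →
    ∑[ x < n ] (ψ u x y * ψ u x y′) ≡ ∏[ i < t ] (+ block-correlation (bit u i) (block y i) (block y′ i))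
  ψ-correlation u y y′ = begin
    ∑[ x < n ] (ψ u x y * ψ u x y′)
      ≡⟨ sum-cong-≗ (λ x → trans (cong₂ _*_ (ψ-factorises u x y) (ψ-factorises u x y′))
                                 (sym (product-distrib-* (f y x) (f y′ x)))) ⟩
    ∑[ x < n ] ∏[ i < t ] (f y x i * f y′ x i)
      ≡⟨ ∑-∏-finToFun t (λ i a → sgn (bit u i ∧ dot m a (block y i)) * sgn (bit u i ∧ dot m a (block y′ i))) ⟩
    ∏[ i < t ] ∑[ a < N ] (sgn (bit u i ∧ dot m a (block y i)) * sgn (bit u i ∧ dot m a (block y′ i)))
      ≡⟨ product-cong-≗ (λ i → ∑-block (bit u i) (block y i) (block y′ i)) ⟩
    ∏[ i < t ] (+ block-correlation (bit u i) (block y i) (block y′ i)) ∎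
    where
    open ≡-Reasoning
    f : Fin n → Fin n → Fin t → ℤ
    f y x i = sgn (bit u i ∧ dot m (block x i) (block y i))

  block-mass : Bool → ℕ
  block-mass false = N ℕ.* N
  block-mass true  = N

  ∑-block-correlation : ∀ c b → ∑[ b′ < N ] (+ block-correlation c b b′) ≡ + block-mass c
  ∑-block-correlation false b = ∑-const N N
  ∑-block-correlation true  b = begin
    ∑[ b′ < N ] (+ (N ℕ.* [ does (b Finₚ.≟ b′) ]))   ≡⟨ sum-cong-≗ (λ b′ → ℤP.pos-* N [ does (b Finₚ.≟ b′) ]) ⟩
    ∑[ b′ < N ] (+ N * + [ does (b Finₚ.≟ b′) ])     ≡⟨ *-distribˡ-sum (+ N) (λ b′ → + [ does (b Finₚ.≟ b′) ]) ⟨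
    + N * ∑[ b′ < N ] (+ [ does (b Finₚ.≟ b′) ])     ≡⟨ cong (+ N *_) (∑-δ b) ⟩
    + N * + 1                                        ≡⟨ ℤP.*-identityʳ (+ N) ⟩
    + N                                              ∎
    where open ≡-Reasoning

  mass : Fin (2 ^ t) → ℕ
  mass u = ℕΣ.product λ i → block-mass (bit u i)

  ∑-correlation : ∀ u y → ∑[ y′ < n ] ∏[ i < t ] (+ block-correlation (bit u i) (block y i) (block y′ i)) ≡ + mass u
  ∑-correlation u y = trans (∑-∏-finToFun t (λ i b′ → + block-correlation (bit u i) (block y i) b′))
                            (trans (product-cong-≗ λ i → ∑-block-correlation (bit u i) (block y i))
                                   (pos-product (λ i → block-mass (bit u i))))

  N*mass≤n² : ∀ u → (∃ λ i → bit u i ≡ true) → N ℕ.* mass u ℕ.≤ n ℕ.* n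
  N*mass≤n² u (j , uⱼ) = ℕP.≤-trans
    (ℕΣ.*-product-≤ (λ i → block-mass (bit u i)) (λ _ → N ℕ.* N) j N (λ i → mass≤N² (bit u i))
                    (ℕP.≤-reflexive (cong (λ c → N ℕ.* block-mass c) uⱼ)))
    (ℕP.≤-reflexive (trans (ℕΣ.product-distrib-* {t} (λ _ → N) (λ _ → N))
                           (cong₂ ℕ._*_ (ℕΣ.product-const t N) (ℕΣ.product-const t N))))
    where
    mass≤N² : ∀ c → block-mass c ℕ.≤ N ℕ.* N
    mass≤N² false = ℕP.≤-refl
    mass≤N² true  = ℕP.m≤m*n N N {{ℕP.m^n≢0 2 m}}

module Discrepancy (m t : ℕ) (A B : Fin (BlockVertices.n m t) → Bool) where

  open ℤΣ
  open Characters
  open CauchySchwarz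
  open BlockVertices m t
  open Cube t using (bit; χ; character-orthogonality)
  open import Data.Integer.Base using (_+_; _*_; _≤_)
  open ℕΣ using (size)

  a : Fin n → ℤ
  a x = + [ A x ]

  b : Fin n → ℤ
  b y = + [ B y ]

  row : Fin (2 ^ t) → Fin n → ℤ
  row u x = ∑[ y < n ] (b y * ψ u x y)

  character-sum : Fin (2 ^ t) → ℤ
  character-sum u = ∑[ x < n ] (a x * row u x)

  ∑row² : ∀ u → ∑[ x < n ] (row u x * row u x) ≤ + (n ℕ.* mass u)
  ∑row² u = begin
    ∑[ x < n ] (row u x * row u x)
      ≡⟨ ∑-square-expand b (ψ u) ⟩
    ∑[ y < n ] ∑[ y′ < n ] ((b y * b y′) * ∑[ x < n ] (ψ u x y * ψ u x y′))
      ≡⟨ sum-cong-≗ (λ y → sum-cong-≗ λ y′ → cong ((b y * b y′) *_) (ψ-correlation u y y′)) ⟩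
    ∑[ y < n ] ∑[ y′ < n ] ((b y * b y′) * Z y y′)
      ≤⟨ sum-mono-≤ (λ y → sum-mono-≤ λ y′ → indicators-≤ (B y) (B y′) (Z≥0 y y′)) ⟩
    ∑[ y < n ] ∑[ y′ < n ] Z y y′
      ≡⟨ sum-cong-≗ (∑-correlation u) ⟩
    ∑[ y < n ] (+ mass u)
      ≡⟨ ∑-const n (mass u) ⟩
    + (n ℕ.* mass u) ∎
    where
    open ℤP.≤-Reasoning
    Z : Fin n → Fin n → ℤ
    Z y y′ = ∏[ i < t ] (+ block-correlation (bit u i) (block y i) (block y′ i))
    Z≥0 : ∀ y y′ → + 0 ≤ Z y y′
    Z≥0 y y′ = subst (+ 0 ≤_) (sym (pos-product (λ i → block-correlation (bit u i) (block y i) (block y′ i)))) (+≤+ z≤n)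
    indicators-≤ : ∀ p q {P} → + 0 ≤ P → (+ [ p ] * + [ q ]) * P ≤ P
    indicators-≤ true  true  {P} _   = ℤP.≤-reflexive (ℤP.*-identityˡ P)
    indicators-≤ true  false     0≤P = 0≤P
    indicators-≤ false q         0≤P = 0≤P

  character-sum²-≤ : ∀ u → character-sum u * character-sum u ≤ + n * + (n ℕ.* mass u)
  character-sum²-≤ u = begin
    character-sum u * character-sum u
      ≤⟨ cauchy-schwarz a (row u) ⟩
    ∑[ x < n ] (a x * a x) * ∑[ x < n ] (row u x * row u x)
      ≤⟨ ℤP.*-monoʳ-≤-nonNeg (∑[ x < n ] (row u x * row u x)) {{∑row²-nonNeg}} ∑a²≤n ⟩
    + n * ∑[ x < n ] (row u x * row u x)
      ≤⟨ ℤP.*-monoˡ-≤-nonNeg (+ n) (∑row² u) ⟩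
    + n * + (n ℕ.* mass u) ∎
    where
    open ℤP.≤-Reasoning
    ∑row²-nonNeg : ℤ.NonNegative (∑[ x < n ] (row u x * row u x))
    ∑row²-nonNeg = ℤ.nonNegative (sum-nonNeg λ x → square-nonNeg (row u x))
    a²≤1 : ∀ p → + [ p ] * + [ p ] ≤ + 1
    a²≤1 true  = ℤP.≤-refl
    a²≤1 false = +≤+ z≤n
    ∑a²≤n : ∑[ x < n ] (a x * a x) ≤ + n
    ∑a²≤n = ℤP.≤-trans (sum-mono-≤ λ x → a²≤1 (A x))
                       (ℤP.≤-reflexive (trans (∑-const n 1) (cong +_ (ℕP.*-identityʳ n))))

  -- Expanding the squares of `row` leaves the correlations of ψ, which vanish off the diagonal of every block
  -- where u is 1; a single such block saves the factor N = R² in the mass bound.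
  discrepancy : ∀ u R → N ≡ R ℕ.* R → (∃ λ i → bit u i ≡ true) → R ℕ.* ∣ character-sum u ∣ ℕ.≤ n ℕ.* n
  discrepancy u R N≡R² nontrivial = square-≤-cancel (R ℕ.* s) (n ℕ.* n) (begin
    (R ℕ.* s) ℕ.* (R ℕ.* s)         ≡⟨ regroup R s ⟩
    (R ℕ.* R) ℕ.* (s ℕ.* s)         ≡⟨ cong (ℕ._* (s ℕ.* s)) N≡R² ⟨
    N ℕ.* (s ℕ.* s)                 ≤⟨ ℕP.*-monoʳ-≤ N s²≤ ⟩
    N ℕ.* (n ℕ.* (n ℕ.* mass u))    ≡⟨ rotate N n (mass u) ⟩
    (n ℕ.* n) ℕ.* (N ℕ.* mass u)    ≤⟨ ℕP.*-monoʳ-≤ (n ℕ.* n) (N*mass≤n² u nontrivial) ⟩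
    (n ℕ.* n) ℕ.* (n ℕ.* n)         ∎)
    where
    open ℕP.≤-Reasoning
    s = ∣ character-sum u ∣
    S²≡s² : character-sum u * character-sum u ≡ + (s ℕ.* s)
    S²≡s² = trans (sym (ℤP.0≤i⇒+∣i∣≡i (square-nonNeg (character-sum u))))
                  (cong +_ (ℤP.abs-* (character-sum u) (character-sum u)))
    s²≤ : s ℕ.* s ℕ.≤ n ℕ.* (n ℕ.* mass u)
    s²≤ = ℤP.drop‿+≤+ (subst₂ _≤_ S²≡s² (sym (ℤP.pos-* n (n ℕ.* mass u))) (character-sum²-≤ u))
    regroup : ∀ r s → (r ℕ.* s) ℕ.* (r ℕ.* s) ≡ (r ℕ.* r) ℕ.* (s ℕ.* s)
    regroup = ℕ-solve
    rotate : ∀ a b c → a ℕ.* (b ℕ.* (b ℕ.* c)) ≡ (b ℕ.* b) ℕ.* (a ℕ.* c)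
    rotate = ℕ-solve

  pair-indicator : Fin (2 ^ t) → Fin n → Fin n → ℕ
  pair-indicator σ x y = [ A x ∧ B y ] ℕ.* [ does (sig x y Finₚ.≟ σ) ]

  signature-count : Fin (2 ^ t) → ℕ
  signature-count σ = ℕΣ.sum λ x → ℕΣ.sum λ y → pair-indicator σ x y

  ∑-characters-of-pair : ∀ σ x y →
    ∑[ u < 2 ^ t ] (χ u σ * (a x * (b y * ψ u x y))) ≡ + (2 ^ t ℕ.* pair-indicator σ x y)
  ∑-characters-of-pair σ x y = begin
    ∑[ u < 2 ^ t ] (χ u σ * (a x * (b y * ψ u x y)))
      ≡⟨ sum-cong-≗ (λ u → rearrange (χ u σ) (a x) (b y) (χ u (sig x y))) ⟩
    ∑[ u < 2 ^ t ] ((a x * b y) * (χ u (sig x y) * χ u σ))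
      ≡⟨ *-distribˡ-sum (a x * b y) (λ u → χ u (sig x y) * χ u σ) ⟨
    (a x * b y) * ∑[ u < 2 ^ t ] (χ u (sig x y) * χ u σ)
      ≡⟨ cong ((a x * b y) *_) (character-orthogonality (sig x y) σ) ⟩
    (a x * b y) * + (2 ^ t ℕ.* δ)
      ≡⟨ trans (cong (_* + (2 ^ t ℕ.* δ)) (sym (ℤP.pos-* [ A x ] [ B y ])))
               (sym (ℤP.pos-* ([ A x ] ℕ.* [ B y ]) (2 ^ t ℕ.* δ))) ⟩
    + (([ A x ] ℕ.* [ B y ]) ℕ.* (2 ^ t ℕ.* δ))
      ≡⟨ cong +_ (trans (swap-scalar [ A x ] [ B y ] (2 ^ t) δ)
                        (cong (λ k → 2 ^ t ℕ.* (k ℕ.* δ)) (sym ([∧] (A x) (B y))))) ⟩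
    + (2 ^ t ℕ.* pair-indicator σ x y) ∎
    where
    open ≡-Reasoning
    δ = [ does (sig x y Finₚ.≟ σ) ]
    rearrange : ∀ c p q d → c * (p * (q * d)) ≡ (p * q) * (d * c)
    rearrange = ℤ-solve
    swap-scalar : ∀ p q k e → (p ℕ.* q) ℕ.* (k ℕ.* e) ≡ k ℕ.* ((p ℕ.* q) ℕ.* e)
    swap-scalar = ℕ-solve

  fourier-inversion : ∀ σ → ∑[ u < 2 ^ t ] (χ u σ * character-sum u) ≡ + (2 ^ t ℕ.* signature-count σ)
  fourier-inversion σ = begin
    ∑[ u < 2 ^ t ] (χ u σ * character-sum u)
      ≡⟨ sum-cong-≗ (λ u → trans (*-distribˡ-sum (χ u σ) (λ x → a x * row u x)) (sum-cong-≗ λ x →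
           trans (cong (χ u σ *_) (*-distribˡ-sum (a x) (λ y → b y * ψ u x y)))
                 (*-distribˡ-sum (χ u σ) (λ y → a x * (b y * ψ u x y))))) ⟩
    ∑[ u < 2 ^ t ] ∑[ x < n ] ∑[ y < n ] F u x y
      ≡⟨ ∑-comm (λ u x → ∑[ y < n ] F u x y) ⟩
    ∑[ x < n ] ∑[ u < 2 ^ t ] ∑[ y < n ] F u x y
      ≡⟨ sum-cong-≗ (λ x → ∑-comm (λ u y → F u x y)) ⟩
    ∑[ x < n ] ∑[ y < n ] ∑[ u < 2 ^ t ] F u x y
      ≡⟨ sum-cong-≗ (λ x → sum-cong-≗ λ y → ∑-characters-of-pair σ x y) ⟩
    ∑[ x < n ] ∑[ y < n ] (+ (2 ^ t ℕ.* pair-indicator σ x y))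
      ≡⟨ trans (sum-cong-≗ λ x → pos-sum (λ y → 2 ^ t ℕ.* pair-indicator σ x y))
               (pos-sum (λ x → ℕΣ.sum λ y → 2 ^ t ℕ.* pair-indicator σ x y)) ⟩
    + ℕΣ.sum (λ x → ℕΣ.sum λ y → 2 ^ t ℕ.* pair-indicator σ x y)
      ≡⟨ cong +_ (trans (ℕΣ.sum-cong-≗ λ x → sym (ℕΣ.*-distribˡ-sum (2 ^ t) (pair-indicator σ x)))
                        (sym (ℕΣ.*-distribˡ-sum (2 ^ t) (λ x → ℕΣ.sum (pair-indicator σ x))))) ⟩
    + (2 ^ t ℕ.* signature-count σ) ∎
    where
    open ≡-Reasoning
    F : Fin (2 ^ t) → Fin n → Fin n → ℤ
    F u x y = χ u σ * (a x * (b y * ψ u x y))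

  zero-indicator : Fin (2 ^ t) → ℤ
  zero-indicator u = ∏[ i < t ] (+ [ not (bit u i) ])

  ∑-zero-indicator : ∑[ u < 2 ^ t ] zero-indicator u ≡ + 1
  ∑-zero-indicator = trans (∑-∏-finToFun t (λ i a → + [ not (Inverse.to 2↔Bool a) ])) (product-one {t} _ λ _ → refl)

  module _ (R : ℕ) (N≡R² : N ≡ R ℕ.* R) where

    character-term-bound : ∀ σ u →
      + R * (χ u σ * character-sum u) ≤ zero-indicator u * + (R ℕ.* (size A ℕ.* size B)) + + (n ℕ.* n)
    character-term-bound σ u with Finₚ.any? (λ i → bit u i Boolₚ.≟ true)
    ... | yes (i , bitᵢ) = begin
      + R * (χ u σ * character-sum u)   ≤⟨ ℤP.*-monoˡ-≤-nonNeg (+ R) χS≤∣S∣ ⟩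
      + R * + ∣ character-sum u ∣       ≡⟨ ℤP.pos-* R ∣ character-sum u ∣ ⟨
      + (R ℕ.* ∣ character-sum u ∣)     ≤⟨ +≤+ (discrepancy u R N≡R² (i , bitᵢ)) ⟩
      + (n ℕ.* n)                       ≡⟨ cong (λ d → d * + (R ℕ.* (size A ℕ.* size B)) + + (n ℕ.* n)) zero-indicator≡0 ⟨
      zero-indicator u * + (R ℕ.* (size A ℕ.* size B)) + + (n ℕ.* n) ∎
      where
      open ℤP.≤-Reasoning
      χS≤∣S∣ : χ u σ * character-sum u ≤ + ∣ character-sum u ∣
      χS≤∣S∣ = subst (λ c → c * character-sum u ≤ + ∣ character-sum u ∣) (sgn-dot t u σ)
                     (sgn*-≤ (dot t u σ) (character-sum u))
      zero-indicator≡0 : zero-indicator u ≡ + 0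
      zero-indicator≡0 = product-zero (λ i → + [ not (bit u i) ]) i (cong (λ c → + [ not c ]) bitᵢ)
    ... | no trivial = begin
      + R * (χ u σ * character-sum u)                   ≡⟨ cong₂ (λ c s → + R * (c * s)) (χ≡1 σ) S≡∣A∣∣B∣ ⟩
      + R * (+ 1 * + (size A ℕ.* size B))               ≡⟨ cong (+ R *_) (ℤP.*-identityˡ _) ⟩
      + R * + (size A ℕ.* size B)                       ≡⟨ ℤP.pos-* R (size A ℕ.* size B) ⟨
      + (R ℕ.* (size A ℕ.* size B))                     ≡⟨ ℤP.*-identityˡ _ ⟨
      + 1 * + (R ℕ.* (size A ℕ.* size B))               ≤⟨ ℤP.i≤i+j _ (+ (n ℕ.* n)) ⟩
      + 1 * + (R ℕ.* (size A ℕ.* size B)) + + (n ℕ.* n)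
        ≡⟨ cong (λ d → d * + (R ℕ.* (size A ℕ.* size B)) + + (n ℕ.* n)) zero-indicator≡1 ⟨
      zero-indicator u * + (R ℕ.* (size A ℕ.* size B)) + + (n ℕ.* n) ∎
      where
      open ℤP.≤-Reasoning
      all-false : ∀ i → bit u i ≡ false
      all-false i = Boolₚ.¬-not (λ bitᵢ → trivial (i , bitᵢ))
      zero-indicator≡1 : zero-indicator u ≡ + 1
      zero-indicator≡1 = product-one _ λ i → cong (λ c → + [ not c ]) (all-false i)
      χ≡1 : ∀ β → χ u β ≡ + 1
      χ≡1 β = product-one _ λ i → cong (λ c → sgn (c ∧ bit β i)) (all-false i)
      S≡∣A∣∣B∣ : character-sum u ≡ + (size A ℕ.* size B)
      S≡∣A∣∣B∣ = begin-equality
        character-sum u           ≡⟨ sum-cong-≗ (λ x → cong (a x *_) (sum-cong-≗ λ y →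
                                         trans (cong (b y *_) (χ≡1 (sig x y))) (ℤP.*-identityʳ (b y)))) ⟩
        ∑[ x < n ] (a x * sum b)  ≡⟨ *-distribʳ-sum (sum b) a ⟨
        sum a * sum b             ≡⟨ cong₂ _*_ (pos-sum (λ x → [ A x ])) (pos-sum (λ y → [ B y ])) ⟩
        + size A * + size B       ≡⟨ ℤP.pos-* (size A) (size B) ⟨
        + (size A ℕ.* size B)     ∎

    signature-count-bound : ∀ σ →
      R ℕ.* (2 ^ t ℕ.* signature-count σ) ℕ.≤ R ℕ.* (size A ℕ.* size B) ℕ.+ 2 ^ t ℕ.* (n ℕ.* n)
    signature-count-bound σ = ℤP.drop‿+≤+ (begin
      + (R ℕ.* (2 ^ t ℕ.* signature-count σ))          ≡⟨ ℤP.pos-* R (2 ^ t ℕ.* signature-count σ) ⟩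
      + R * + (2 ^ t ℕ.* signature-count σ)            ≡⟨ cong (+ R *_) (fourier-inversion σ) ⟨
      + R * ∑[ u < 2 ^ t ] (χ u σ * character-sum u)   ≡⟨ *-distribˡ-sum (+ R) (λ u → χ u σ * character-sum u) ⟩
      ∑[ u < 2 ^ t ] (+ R * (χ u σ * character-sum u)) ≤⟨ sum-mono-≤ (character-term-bound σ) ⟩
      ∑[ u < 2 ^ t ] (zero-indicator u * + X + + (n ℕ.* n))
        ≡⟨ ∑-distrib-+ (λ u → zero-indicator u * + X) (λ _ → + (n ℕ.* n)) ⟩
      ∑[ u < 2 ^ t ] (zero-indicator u * + X) + ∑[ u < 2 ^ t ] (+ (n ℕ.* n))
        ≡⟨ cong₂ _+_ (trans (sym (*-distribʳ-sum (+ X) zero-indicator)) (cong (_* + X) ∑-zero-indicator))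
                     (∑-const (2 ^ t) (n ℕ.* n)) ⟩
      + 1 * + X + + (2 ^ t ℕ.* (n ℕ.* n))              ≡⟨ cong (_+ + (2 ^ t ℕ.* (n ℕ.* n))) (ℤP.*-identityˡ (+ X)) ⟩
      + X + + (2 ^ t ℕ.* (n ℕ.* n))                    ≡⟨ ℤP.pos-+ X (2 ^ t ℕ.* (n ℕ.* n)) ⟨
      + (X ℕ.+ 2 ^ t ℕ.* (n ℕ.* n))                    ∎)
      where
      open ℤP.≤-Reasoning
      X = R ℕ.* (size A ℕ.* size B)

module ResidueClass (q : ℕ) .{{_ : NonZero q}} (γ : Fin q) where

  open ℕΣ
  open import Data.Nat.Base using (_+_; _*_; _≤_)

  inClass : ℕ → ℕ
  inClass k = [ does (k mod q Finₚ.≟ γ) ]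

  count : ℕ → ℕ
  count K = ∑[ i < K ] inClass (toℕ i)

  toℕ-mod : ∀ (i : Fin q) → toℕ i mod q ≡ i
  toℕ-mod i = Finₚ.toℕ-injective (trans (Finₚ.toℕ-fromℕ< _) (DivMod.m<n⇒m%n≡m (Finₚ.toℕ<n i)))

  count-q : count q ≡ 1
  count-q = trans (sum-cong-≗ {q} λ i → trans (cong (λ j → [ does (j Finₚ.≟ γ) ]) (toℕ-mod i)) (cong [_] (does-≟-comm i γ)))
                  (∑-δ γ)

  count-↑ : ∀ K d → count (K + d) ≡ count K + ∑[ j < d ] inClass (K + toℕ j)
  count-↑ K d = trans (sum-↑ K d (λ i → inClass (toℕ i)))
    (cong₂ _+_ (sum-cong-≗ {K} λ i → cong inClass (Finₚ.toℕ-↑ˡ i d))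
               (sum-cong-≗ {d} λ j → cong inClass (Finₚ.toℕ-↑ʳ K j)))

  count-mono : ∀ {K L} → K ≤ L → count K ≤ count L
  count-mono {K} {L} K≤L = subst (λ L → count K ≤ count L) (ℕP.m+[n∸m]≡n K≤L)
    (subst (count K ≤_) (sym (count-↑ K (L ℕ.∸ K))) (ℕP.m≤m+n (count K) _))

  count-shift : ∀ K → count (q + K) ≡ 1 + count K
  count-shift K = trans (count-↑ q K)
    (cong₂ _+_ count-q (sum-cong-≗ {K} λ j → cong (λ k → [ does (k Finₚ.≟ γ) ]) (mod-shift (toℕ j))))
    where
    mod-shift : ∀ k → (q + k) mod q ≡ k mod q
    mod-shift k = Finₚ.toℕ-injective (trans (Finₚ.toℕ-fromℕ< _)
      (trans (trans (cong (_% q) (ℕP.+-comm q k)) (DivMod.[m+n]%n≡m%n k q)) (sym (Finₚ.toℕ-fromℕ< _))))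

  count-periodic : ∀ k r → r ≤ q → q * count (k * q + r) ≤ k * q + r + q
  count-periodic zero    r r≤q = begin
    q * count r     ≤⟨ ℕP.*-monoʳ-≤ q (subst (count r ≤_) count-q (count-mono r≤q)) ⟩
    q * 1           ≡⟨ ℕP.*-identityʳ q ⟩
    q               ≤⟨ ℕP.m≤n+m q r ⟩
    r + q           ∎
    where open ℕP.≤-Reasoning
  count-periodic (suc k) r r≤q = begin
    q * count (q + k * q + r)       ≡⟨ cong (λ K → q * count K) (ℕP.+-assoc q (k * q) r) ⟩
    q * count (q + (k * q + r))     ≡⟨ cong (q *_) (count-shift (k * q + r)) ⟩
    q * (1 + count (k * q + r))     ≡⟨ ℕP.*-distribˡ-+ q 1 _ ⟩
    q * 1 + q * count (k * q + r)   ≤⟨ ℕP.+-mono-≤ (ℕP.≤-reflexive (ℕP.*-identityʳ q)) (count-periodic k r r≤q) ⟩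
    q + (k * q + r + q)             ≡⟨ trans (cong (_+ q) (ℕP.+-assoc q (k * q) r)) (ℕP.+-assoc q (k * q + r) q) ⟨
    q + k * q + r + q               ∎
    where open ℕP.≤-Reasoning

  residue-count : ∀ K → q * count K ≤ K + q
  residue-count K = subst (λ K → q * count K ≤ K + q) (sym (trans (DivMod.m≡m%n+[m/n]*n K q) (ℕP.+-comm (K % q) _)))
    (count-periodic (K DivMod./ q) (K % q) (ℕP.<⇒≤ (DivMod.m%n<n K q)))

monochromatic : ∀ {q} → Fin q → Fin q → Fin q → Bool
monochromatic a b c = does (a Finₚ.≟ b) ∧ does (a Finₚ.≟ c)

monochromatic-swap₁₂ : ∀ {q} (a b c : Fin q) → monochromatic a b c ≡ monochromatic b a c
monochromatic-swap₁₂ a b c with a Finₚ.≟ b | does-≟-comm a b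
... | yes refl | _              = cong (_∧ does (a Finₚ.≟ c)) (sym (dec-true (a Finₚ.≟ a) refl))
... | no  _    | a≟b≡b≟a rewrite sym a≟b≡b≟a = refl

monochromatic-swap₂₃ : ∀ {q} (a b c : Fin q) → monochromatic a b c ≡ monochromatic a c b
monochromatic-swap₂₃ a b c = Boolₚ.∧-comm (does (a Finₚ.≟ b)) (does (a Finₚ.≟ c))

monochromatic-true : ∀ {q} {a b c : Fin q} → a ≡ b → a ≡ c → monochromatic a b c ≡ true
monochromatic-true {a = a} {b} {c} a≡b a≡c = cong₂ _∧_ (dec-true (a Finₚ.≟ b) a≡b) (dec-true (a Finₚ.≟ c) a≡c)

monochromatic-true⁻¹ : ∀ {q} {a b c : Fin q} → monochromatic a b c ≡ true → a ≡ b × a ≡ c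
monochromatic-true⁻¹ {a = a} {b} {c} mono with a Finₚ.≟ b | a Finₚ.≟ c | mono
... | yes a≡b | yes a≡c | _ = a≡b , a≡c

distinct : ∀ {n} → Fin n → Fin n → Bool
distinct x y = not (does (x Finₚ.≟ y))

distinct-true : ∀ {n} {x y : Fin n} → distinct x y ≡ true → x ≢ y
distinct-true {x = x} {y} d with x Finₚ.≟ y | d
... | no x≢y | _ = x≢y

module Construction (m t q : ℕ) .{{_ : NonZero q}} where

  open BlockVertices m t public
  open import Algebra.Properties.CommutativeSemigroup (CommutativeMonoid.commutativeSemigroup Boolₚ.∧-commutativeMonoid)
    using (x∙yz≈y∙xz)

  colour : Fin n → Fin n → Fin q
  colour x y = toℕ (sig x y) mod q

  colour-comm : ∀ x y → colour x y ≡ colour y x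
  colour-comm x y = cong (λ s → toℕ s mod q) (sig-comm x y)

  edge : Fin n → Fin n → Fin n → Bool
  edge x y z = distinct x y ∧ distinct x z ∧ distinct y z ∧ not (monochromatic (colour x y) (colour x z) (colour y z))

  edge-swap₁₂ : ∀ x y z → edge x y z ≡ edge y x z
  edge-swap₁₂ x y z
    rewrite does-≟-comm y x | colour-comm y x | monochromatic-swap₂₃ (colour x y) (colour y z) (colour x z)
    = cong (distinct x y ∧_) (x∙yz≈y∙xz (distinct x z) (distinct y z) _)

  edge-swap₂₃ : ∀ x y z → edge x y z ≡ edge x z y
  edge-swap₂₃ x y z
    rewrite does-≟-comm z y | colour-comm z y | monochromatic-swap₁₂ (colour x z) (colour x y) (colour y z)
    = x∙yz≈y∙xz (distinct x y) (distinct x z) _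

  edge-distinct : ∀ x y z → edge x y z ≡ true → x ≢ y × x ≢ z × y ≢ z
  edge-distinct x y z e = distinct-true (∧-conicalˡ (distinct x y) _ e) ,
                          distinct-true (∧-conicalˡ (distinct x z) _ e₂) ,
                          distinct-true (∧-conicalˡ (distinct y z) _ (∧-conicalʳ (distinct x z) _ e₂))
    where
    open Boolₚ using (∧-conicalˡ; ∧-conicalʳ)
    e₂ = ∧-conicalʳ (distinct x y) _ e

  edge-not-monochromatic : ∀ x y z → edge x y z ≡ true →
                           monochromatic (colour x y) (colour x z) (colour y z) ≡ false
  edge-not-monochromatic x y z e = Boolₚ.not-injective
    (∧-conicalʳ (distinct y z) _ (∧-conicalʳ (distinct x z) _ (∧-conicalʳ (distinct x y) _ e)))
    where open Boolₚ using (∧-conicalʳ)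

  hypergraph : Hypergraph3 n
  hypergraph = record { edge = edge ; sym₁₂ = edge-swap₁₂ ; sym₂₃ = edge-swap₂₃ ; distinct = edge-distinct }

  clique-free : ∀ {k₀ k} → Arrows q k₀ → k₀ ℕ.≤ k → CliqueFree k hypergraph
  clique-free {k₀} arrows k₀≤k f _ clique = no-monochromatic-triangle (arrows induced)
    where
    ι : Fin k₀ → Fin _
    ι i = inject≤ i k₀≤k
    ι-≢ : ∀ {i j} → i ≢ j → ι i ≢ ι j
    ι-≢ {i} {j} i≢j ιi≡ιj = i≢j (Finₚ.inject≤-injective k₀≤k k₀≤k i j ιi≡ιj)
    induced : Colouring q k₀
    induced = record { col = λ i j → colour (f (ι i)) (f (ι j)) ; sym = λ i j _ → colour-comm (f (ι i)) (f (ι j)) }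
    no-monochromatic-triangle : MonoTriangle induced → ⊥
    no-monochromatic-triangle (a , b , d , a≢b , a≢d , b≢d , ab≡ad , ab≡bd)
      with () ← trans (sym (monochromatic-true ab≡ad ab≡bd))
                      (edge-not-monochromatic _ _ _ (clique (ι a) (ι b) (ι d) (ι-≢ a≢b) (ι-≢ a≢d) (ι-≢ b≢d)))

module ColourClasses (m t q : ℕ) .{{_ : NonZero q}} where

  open ℕΣ
  open Construction m t q
  open import Data.Nat.Base using (_+_; _*_; _≤_)

  class-pairs : (A B : Fin n → Bool) → Fin q → ℕ
  class-pairs A B γ = ∑[ x < n ] ∑[ y < n ] [ A x ∧ B y ∧ does (colour x y Finₚ.≟ γ) ]

  module _ (A B : Fin n → Bool) (γ : Fin q) where

    open ResidueClass q γ
    open Discrepancy m t A B using (pair-indicator; signature-count; signature-count-bound)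

    class-pairs-by-signature : class-pairs A B γ ≡ ∑[ σ < 2 ^ t ] (inClass (toℕ σ) * signature-count σ)
    class-pairs-by-signature = begin
      ∑[ x < n ] ∑[ y < n ] [ A x ∧ B y ∧ does (colour x y Finₚ.≟ γ) ]
        ≡⟨ sum-cong-≗ (λ x → sum-cong-≗ λ y → expand x y) ⟩
      ∑[ x < n ] ∑[ y < n ] ∑[ σ < 2 ^ t ] F σ x y
        ≡⟨ sum-cong-≗ (λ x → ∑-comm (λ y σ → F σ x y)) ⟩
      ∑[ x < n ] ∑[ σ < 2 ^ t ] ∑[ y < n ] F σ x y
        ≡⟨ ∑-comm (λ x σ → ∑[ y < n ] F σ x y) ⟩
      ∑[ σ < 2 ^ t ] ∑[ x < n ] ∑[ y < n ] F σ x y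
        ≡⟨ sum-cong-≗ (λ σ → trans (sum-cong-≗ λ x → sym (*-distribˡ-sum (inClass (toℕ σ)) (pair-indicator σ x)))
                                   (sym (*-distribˡ-sum (inClass (toℕ σ)) (λ x → ∑[ y < n ] pair-indicator σ x y)))) ⟩
      ∑[ σ < 2 ^ t ] (inClass (toℕ σ) * signature-count σ) ∎
      where
      open ≡-Reasoning
      F : Fin (2 ^ t) → Fin n → Fin n → ℕ
      F σ x y = inClass (toℕ σ) * pair-indicator σ x y
      expand : ∀ x y → [ A x ∧ B y ∧ does (colour x y Finₚ.≟ γ) ] ≡ ∑[ σ < 2 ^ t ] F σ x y
      expand x y = begin
        [ A x ∧ B y ∧ does (colour x y Finₚ.≟ γ) ]
          ≡⟨ [∧∧] (A x) (B y) _ ⟩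
        [ A x ∧ B y ] * inClass (toℕ (sig x y))
          ≡⟨ cong ([ A x ∧ B y ] *_) (∑-δ* (sig x y) (λ σ → inClass (toℕ σ))) ⟨
        [ A x ∧ B y ] * ∑[ σ < 2 ^ t ] ([ does (sig x y Finₚ.≟ σ) ] * inClass (toℕ σ))
          ≡⟨ *-distribˡ-sum [ A x ∧ B y ] (λ σ → [ does (sig x y Finₚ.≟ σ) ] * inClass (toℕ σ)) ⟩
        ∑[ σ < 2 ^ t ] ([ A x ∧ B y ] * ([ does (sig x y Finₚ.≟ σ) ] * inClass (toℕ σ)))
          ≡⟨ sum-cong-≗ (λ σ → rotate [ A x ∧ B y ] [ does (sig x y Finₚ.≟ σ) ] (inClass (toℕ σ))) ⟩
        ∑[ σ < 2 ^ t ] F σ x y ∎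
        where
        rotate : ∀ a b c → a * (b * c) ≡ c * (a * b)
        rotate = ℕ-solve

    class-pairs-bound : ∀ R → N ≡ R * R →
      q * (R * (2 ^ t * class-pairs A B γ)) ≤ (2 ^ t + q) * (R * (size A * size B) + 2 ^ t * (n * n))
    class-pairs-bound R N≡R² = begin
      q * (R * (2 ^ t * class-pairs A B γ))
        ≡⟨ cong (λ p → q * (R * (2 ^ t * p))) class-pairs-by-signature ⟩
      q * (R * (2 ^ t * ∑[ σ < 2 ^ t ] (inClass (toℕ σ) * signature-count σ)))
        ≡⟨ cong (q *_) (trans (cong (R *_) (*-distribˡ-sum (2 ^ t) (λ σ → inClass (toℕ σ) * signature-count σ)))
                              (*-distribˡ-sum R (λ σ → 2 ^ t * (inClass (toℕ σ) * signature-count σ)))) ⟩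
      q * ∑[ σ < 2 ^ t ] (R * (2 ^ t * (inClass (toℕ σ) * signature-count σ)))
        ≡⟨ cong (q *_) (sum-cong-≗ λ σ → rotate R (2 ^ t) (inClass (toℕ σ)) (signature-count σ)) ⟩
      q * ∑[ σ < 2 ^ t ] (inClass (toℕ σ) * (R * (2 ^ t * signature-count σ)))
        ≤⟨ ℕP.*-monoʳ-≤ q (sum-mono-≤ λ σ → ℕP.*-monoʳ-≤ (inClass (toℕ σ)) (signature-count-bound R N≡R² σ)) ⟩
      q * ∑[ σ < 2 ^ t ] (inClass (toℕ σ) * bound)
        ≡⟨ cong (q *_) (*-distribʳ-sum {2 ^ t} bound (λ σ → inClass (toℕ σ))) ⟨
      q * (count (2 ^ t) * bound)
        ≡⟨ ℕP.*-assoc q (count (2 ^ t)) bound ⟨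
      q * count (2 ^ t) * bound
        ≤⟨ ℕP.*-monoˡ-≤ bound (residue-count (2 ^ t)) ⟩
      (2 ^ t + q) * bound ∎
      where
      open ℕP.≤-Reasoning
      bound = R * (size A * size B) + 2 ^ t * (n * n)
      rotate : ∀ r p c k → r * (p * (c * k)) ≡ c * (r * (p * k))
      rotate = ℕ-solve

module Link (m t q : ℕ) .{{_ : NonZero q}} (P Q : Rel (BlockVertices.n m t)) (x : Fin (BlockVertices.n m t)) where

  open ℕΣ
  open Construction m t q
  open ColourClasses m t q using (class-pairs)
  open import Data.Nat.Base using (_+_; _*_; _≤_)

  A : Fin q → Fin n → Bool
  A γ y = P x y ∧ does (colour x y Finₚ.≟ γ)

  B : Fin q → Fin n → Bool
  B γ z = Q x z ∧ does (colour x z Finₚ.≟ γ)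

  link : ℕ
  link = ∑[ y < n ] ∑[ z < n ] [ P x y ∧ Q x z ]

  link-edges : ℕ
  link-edges = ∑[ y < n ] ∑[ z < n ] [ P x y ∧ Q x z ∧ edge x y z ]

  degenerate : Fin n → Fin n → ℕ
  degenerate y z = [ does (x Finₚ.≟ y) ] + [ does (x Finₚ.≟ z) ] + [ does (y Finₚ.≟ z) ]

  monochromatic-classes : Fin n → Fin n → ℕ
  monochromatic-classes y z = ∑[ γ < q ] [ A γ y ∧ B γ z ∧ does (colour y z Finₚ.≟ γ) ]

  monochromatic-bound : ∀ {y z} → P x y ≡ true → Q x z ≡ true →
    monochromatic (colour x y) (colour x z) (colour y z) ≡ true → 1 ≤ monochromatic-classes y z
  monochromatic-bound {y} {z} Pxy Qxz mono = ℕP.≤-trans (ℕP.≤-reflexive (sym class-of-xy))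
    (term-≤-sum (λ γ → [ A γ y ∧ B γ z ∧ does (colour y z Finₚ.≟ γ) ]) (colour x y))
    where
    same = monochromatic-true⁻¹ mono
    class-of-xy : [ A (colour x y) y ∧ B (colour x y) z ∧ does (colour y z Finₚ.≟ colour x y) ] ≡ 1
    class-of-xy rewrite Pxy | Qxz
      | dec-true (colour x y Finₚ.≟ colour x y) refl
      | dec-true (colour x z Finₚ.≟ colour x y) (sym (proj₁ same))
      | dec-true (colour y z Finₚ.≟ colour x y) (sym (proj₂ same)) = refl

  non-edge-bound : ∀ y z → P x y ≡ true → Q x z ≡ true → edge x y z ≡ false →
                   1 ≤ degenerate y z + monochromatic-classes y z
  non-edge-bound y z Pxy Qxz non-edge with x Finₚ.≟ y | x Finₚ.≟ z | y Finₚ.≟ z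
  ... | yes _ | _     | _     = s≤s z≤n
  ... | no  _ | yes _ | _     = s≤s z≤n
  ... | no  _ | no  _ | yes _ = s≤s z≤n
  -- with x, y, z distinct, the type of non-edge has reduced to `not (monochromatic …) ≡ false`
  ... | no  _ | no  _ | no  _ = monochromatic-bound Pxy Qxz (Boolₚ.not-injective non-edge)

  pair-bound : ∀ y z → [ P x y ∧ Q x z ] ≤ [ P x y ∧ Q x z ∧ edge x y z ] + (degenerate y z + monochromatic-classes y z)
  pair-bound y z = indicator-split (P x y) (Q x z) (edge x y z) (non-edge-bound y z)

  degenerate-sum : ∑[ y < n ] ∑[ z < n ] degenerate y z ≡ n + n + n
  degenerate-sum = begin
    ∑[ y < n ] ∑[ z < n ] degenerate y z
      ≡⟨ trans (∑∑-distrib-+ (λ y z → [ does (x Finₚ.≟ y) ] + [ does (x Finₚ.≟ z) ]) (λ y z → [ does (y Finₚ.≟ z) ]))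
               (cong (_+ _) (∑∑-distrib-+ (λ y z → [ does (x Finₚ.≟ y) ]) (λ y z → [ does (x Finₚ.≟ z) ]))) ⟩
    ∑[ y < n ] ∑[ z < n ] [ does (x Finₚ.≟ y) ] + ∑[ y < n ] ∑[ z < n ] [ does (x Finₚ.≟ z) ]
      + ∑[ y < n ] ∑[ z < n ] [ does (y Finₚ.≟ z) ]
      ≡⟨ cong₂ _+_ (cong₂ _+_ first (sum-of-ones (λ y → ∑-δ x))) (sum-of-ones ∑-δ) ⟩
    n + n + n ∎
    where
    open ≡-Reasoning
    sum-of-ones : ∀ {f : Fin n → ℕ} → (∀ y → f y ≡ 1) → sum f ≡ n
    sum-of-ones f≡1 = trans (sum-cong-≗ f≡1) (trans (∑-const n 1) (ℕP.*-identityʳ n))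
    first : ∑[ y < n ] ∑[ z < n ] [ does (x Finₚ.≟ y) ] ≡ n
    first = begin
      ∑[ y < n ] ∑[ z < n ] [ does (x Finₚ.≟ y) ]   ≡⟨ sum-cong-≗ (λ y → ∑-const n [ does (x Finₚ.≟ y) ]) ⟩
      ∑[ y < n ] (n * [ does (x Finₚ.≟ y) ])       ≡⟨ *-distribˡ-sum n (λ y → [ does (x Finₚ.≟ y) ]) ⟨
      n * ∑[ y < n ] [ does (x Finₚ.≟ y) ]         ≡⟨ cong (n *_) (∑-δ x) ⟩
      n * 1                                        ≡⟨ ℕP.*-identityʳ n ⟩
      n                                            ∎

  monochromatic-sum : ∑[ y < n ] ∑[ z < n ] monochromatic-classes y z ≡ ∑[ γ < q ] class-pairs (A γ) (B γ) γ
  monochromatic-sum = trans (sum-cong-≗ λ y → ∑-comm (λ z γ → F γ y z)) (∑-comm (λ y γ → ∑[ z < n ] F γ y z))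
    where
    F : Fin q → Fin n → Fin n → ℕ
    F γ y z = [ A γ y ∧ B γ z ∧ does (colour y z Finₚ.≟ γ) ]

  link-bound : link ≤ link-edges + (n + n + n + ∑[ γ < q ] class-pairs (A γ) (B γ) γ)
  link-bound = begin
    link
      ≤⟨ sum-mono-≤ (λ y → sum-mono-≤ λ z → pair-bound y z) ⟩
    ∑[ y < n ] ∑[ z < n ] ([ P x y ∧ Q x z ∧ edge x y z ] + (degenerate y z + monochromatic-classes y z))
      ≡⟨ ∑∑-distrib-+ (λ y z → [ P x y ∧ Q x z ∧ edge x y z ]) (λ y z → degenerate y z + monochromatic-classes y z) ⟩
    link-edges + ∑[ y < n ] ∑[ z < n ] (degenerate y z + monochromatic-classes y z)
      ≡⟨ cong (link-edges ℕ.+_) (trans (∑∑-distrib-+ degenerate monochromatic-classes)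
                                       (cong₂ _+_ degenerate-sum monochromatic-sum)) ⟩
    link-edges + (n + n + n + ∑[ γ < q ] class-pairs (A γ) (B γ) γ) ∎
    where open ℕP.≤-Reasoning

  link-factorises : link ≡ size (P x) * size (Q x)
  link-factorises = trans (sum-cong-≗ λ y → sum-cong-≗ λ z → [∧] (P x y) (Q x z))
                          (∑∑-* (λ y → [ P x y ]) (λ z → [ Q x z ]))

  class-sizes : ∑[ γ < q ] size (A γ) ≡ size (P x)
  class-sizes = begin
    ∑[ γ < q ] ∑[ y < n ] [ A γ y ]
      ≡⟨ ∑-comm (λ γ y → [ A γ y ]) ⟩
    ∑[ y < n ] ∑[ γ < q ] [ P x y ∧ does (colour x y Finₚ.≟ γ) ]
      ≡⟨ sum-cong-≗ (λ y → trans (sum-cong-≗ λ γ → [∧] (P x y) (does (colour x y Finₚ.≟ γ)))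
                                 (sym (*-distribˡ-sum [ P x y ] (λ γ → [ does (colour x y Finₚ.≟ γ) ])))) ⟩
    ∑[ y < n ] ([ P x y ] * ∑[ γ < q ] [ does (colour x y Finₚ.≟ γ) ])
      ≡⟨ sum-cong-≗ (λ y → trans (cong ([ P x y ] *_) (∑-δ (colour x y))) (ℕP.*-identityʳ [ P x y ])) ⟩
    size (P x) ∎
    where open ≡-Reasoning

  class-products-bound : ∑[ γ < q ] (size (A γ) * size (B γ)) ≤ link
  class-products-bound = begin
    ∑[ γ < q ] (size (A γ) * size (B γ))
      ≤⟨ sum-mono-≤ (λ γ → ℕP.*-monoʳ-≤ (size (A γ)) (sum-mono-≤ λ z → [∧]-≤ (Q x z) _)) ⟩
    ∑[ γ < q ] (size (A γ) * size (Q x))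
      ≡⟨ *-distribʳ-sum (size (Q x)) (λ γ → size (A γ)) ⟨
    ∑[ γ < q ] size (A γ) * size (Q x)
      ≡⟨ cong (_* size (Q x)) class-sizes ⟩
    size (P x) * size (Q x)
      ≡⟨ link-factorises ⟨
    link ∎
    where open ℕP.≤-Reasoning

module Density (m t q : ℕ) .{{_ : NonZero q}} (R : ℕ) where

  open ℕΣ
  open Construction m t q
  open ColourClasses m t q
  open import Data.Nat.Base using (_+_; _*_; _≤_)

  module _ (N≡R² : N ≡ R * R) (R≤n : R ≤ n) (P Q : Rel n) (x : Fin n) where

    open Link m t q P Q x

    classes-bound : q * (R * (2 ^ t * ∑[ γ < q ] class-pairs (A γ) (B γ) γ)) ≤ (2 ^ t + q) * (R * link + q * (2 ^ t * (n * n)))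
    classes-bound = begin
      q * (R * (2 ^ t * ∑[ γ < q ] p γ))
        ≡⟨ cong (λ s → q * (R * s)) (*-distribˡ-sum (2 ^ t) p) ⟩
      q * (R * ∑[ γ < q ] (2 ^ t * p γ))
        ≡⟨ cong (q *_) (*-distribˡ-sum R (λ γ → 2 ^ t * p γ)) ⟩
      q * ∑[ γ < q ] (R * (2 ^ t * p γ))
        ≡⟨ *-distribˡ-sum q (λ γ → R * (2 ^ t * p γ)) ⟩
      ∑[ γ < q ] (q * (R * (2 ^ t * p γ)))
        ≤⟨ sum-mono-≤ (λ γ → class-pairs-bound (A γ) (B γ) γ R N≡R²) ⟩
      ∑[ γ < q ] ((2 ^ t + q) * (R * (size (A γ) * size (B γ)) + 2 ^ t * (n * n)))
        ≡⟨ *-distribˡ-sum (2 ^ t + q) (λ γ → R * (size (A γ) * size (B γ)) + 2 ^ t * (n * n)) ⟨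
      (2 ^ t + q) * ∑[ γ < q ] (R * (size (A γ) * size (B γ)) + 2 ^ t * (n * n))
        ≡⟨ cong ((2 ^ t + q) *_) (trans (∑-distrib-+ (λ γ → R * (size (A γ) * size (B γ))) (λ _ → 2 ^ t * (n * n)))
              (cong₂ _+_ (sym (*-distribˡ-sum R (λ γ → size (A γ) * size (B γ)))) (∑-const q (2 ^ t * (n * n))))) ⟩
      (2 ^ t + q) * (R * ∑[ γ < q ] (size (A γ) * size (B γ)) + q * (2 ^ t * (n * n)))
        ≤⟨ ℕP.*-monoʳ-≤ (2 ^ t + q) (ℕP.+-monoˡ-≤ _ (ℕP.*-monoʳ-≤ R class-products-bound)) ⟩
      (2 ^ t + q) * (R * link + q * (2 ^ t * (n * n))) ∎
      where
      open ℕP.≤-Reasoning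
      p = λ γ → class-pairs (A γ) (B γ) γ

    link-inequality : R * (q * 2 ^ t) * link ≤
      R * (q * 2 ^ t) * link-edges + R * (2 ^ t + q) * link + (q * 2 ^ t) * (3 + 2 ^ t + q) * (n * n)
    link-inequality = begin
      R * (q * 2 ^ t) * link
        ≤⟨ ℕP.*-monoʳ-≤ (R * (q * 2 ^ t)) link-bound ⟩
      R * (q * 2 ^ t) * (link-edges + (n + n + n + Σp))
        ≡⟨ expand R q (2 ^ t) link-edges n Σp ⟩
      R * (q * 2 ^ t) * link-edges + q * 2 ^ t * (3 * (R * n)) + q * (R * (2 ^ t * Σp))
        ≤⟨ ℕP.+-mono-≤ (ℕP.+-monoʳ-≤ _ (ℕP.*-monoʳ-≤ (q * 2 ^ t) (ℕP.*-monoʳ-≤ 3 (ℕP.*-monoˡ-≤ n R≤n))))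
                       classes-bound ⟩
      R * (q * 2 ^ t) * link-edges + q * 2 ^ t * (3 * (n * n)) + (2 ^ t + q) * (R * link + q * (2 ^ t * (n * n)))
        ≡⟨ collect R q (2 ^ t) link-edges link n ⟩
      R * (q * 2 ^ t) * link-edges + R * (2 ^ t + q) * link + (q * 2 ^ t) * (3 + 2 ^ t + q) * (n * n) ∎
      where
      open ℕP.≤-Reasoning
      Σp = ∑[ γ < q ] class-pairs (A γ) (B γ) γ
      expand : ∀ R q T E n S → R * (q * T) * (E + (n + n + n + S)) ≡ R * (q * T) * E + q * T * (3 * (R * n)) + q * (R * (T * S))
      expand = ℕ-solve
      collect : ∀ R q T E L n → R * (q * T) * E + q * T * (3 * (n * n)) + (T + q) * (R * L + q * (T * (n * n)))
                              ≡ R * (q * T) * E + R * (T + q) * L + (q * T) * (3 + T + q) * (n * n)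
      collect = ℕ-solve

  counting-inequality : N ≡ R * R → R ≤ n → ∀ P Q →
    R * (q * 2 ^ t) * sizeK P Q ≤
    R * (q * 2 ^ t) * ePQ hypergraph P Q + R * (2 ^ t + q) * sizeK P Q + (q * 2 ^ t) * (3 + 2 ^ t + q) * n ^ 3
  counting-inequality N≡R² R≤n P Q = begin
    a * sizeK P Q
      ≡⟨ cong (a *_) sizeK≡ ⟩
    a * ∑[ x < n ] L.link x
      ≡⟨ *-distribˡ-sum a L.link ⟩
    ∑[ x < n ] (a * L.link x)
      ≤⟨ sum-mono-≤ (link-inequality N≡R² R≤n P Q) ⟩
    ∑[ x < n ] (a * L.link-edges x + b * L.link x + c * (n * n))
      ≡⟨ trans (∑-distrib-+ (λ x → a * L.link-edges x + b * L.link x) (λ _ → c * (n * n)))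
               (cong₂ _+_ (trans (∑-distrib-+ (λ x → a * L.link-edges x) (λ x → b * L.link x))
                                 (cong₂ _+_ (sym (*-distribˡ-sum a L.link-edges)) (sym (*-distribˡ-sum b L.link))))
                          (∑-const n (c * (n * n)))) ⟩
    a * ∑[ x < n ] L.link-edges x + b * ∑[ x < n ] L.link x + n * (c * (n * n))
      ≡⟨ cong₂ (λ e k → a * e + b * k + n * (c * (n * n))) (sym ePQ≡) (sym sizeK≡) ⟩
    a * ePQ hypergraph P Q + b * sizeK P Q + n * (c * (n * n))
      ≡⟨ cong (ℕ._+_ (a * ePQ hypergraph P Q + b * sizeK P Q)) (cube c n) ⟩
    a * ePQ hypergraph P Q + b * sizeK P Q + c * n ^ 3 ∎
    where
    open ℕP.≤-Reasoning
    module L (x : Fin n) = Link m t q P Q x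
    a = R * (q * 2 ^ t)
    b = R * (2 ^ t + q)
    c = (q * 2 ^ t) * (3 + 2 ^ t + q)
    ΣFin³ : ∀ (F : Fin n → Fin n → Fin n → ℕ) →
            ΣFin n (λ x → ΣFin n λ y → ΣFin n λ z → F x y z) ≡ ∑[ x < n ] ∑[ y < n ] ∑[ z < n ] F x y z
    ΣFin³ F = trans (ΣFin≡sum n _) (sum-cong-≗ λ x → trans (ΣFin≡sum n _) (sum-cong-≗ λ y → ΣFin≡sum n (F x y)))
    sizeK≡ : sizeK P Q ≡ ∑[ x < n ] L.link x
    sizeK≡ = ΣFin³ (λ x y z → [ P x y ∧ Q x z ])
    ePQ≡ : ePQ hypergraph P Q ≡ ∑[ x < n ] L.link-edges x
    ePQ≡ = ΣFin³ (λ x y z → [ P x y ∧ Q x z ∧ edge x y z ])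
    cube : ∀ c n → n * (c * (n * n)) ≡ c * (n * (n * (n * 1)))
    cube = ℕ-solve

module RationalArithmetic where

  open import Data.Rational.Base using (_+_; _-_; _*_; _≤_; -_)
  open +-*-Solver

  ℕ→ℚ-coprime : ∀ a → ℕ→ℚ a ≡ mkℚ (+ a) 0 (Coprimality.sym (Coprimality.1-coprimeTo a))
  ℕ→ℚ-coprime a = ℚP.normalize-coprime (Coprimality.sym (Coprimality.1-coprimeTo a))

  toℚᵘ-ℕ→ℚ : ∀ a → toℚᵘ (ℕ→ℚ a) ≡ mkℚᵘ (+ a) 0
  toℚᵘ-ℕ→ℚ a = cong toℚᵘ (ℕ→ℚ-coprime a)

  ℕ→ℚ-+ : ∀ a b → ℕ→ℚ (a ℕ.+ b) ≡ ℕ→ℚ a + ℕ→ℚ b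
  ℕ→ℚ-+ a b = ℚP.toℚᵘ-injective (begin
    toℚᵘ (ℕ→ℚ (a ℕ.+ b))                 ≡⟨ toℚᵘ-ℕ→ℚ (a ℕ.+ b) ⟩
    mkℚᵘ (+ (a ℕ.+ b)) 0                 ≈⟨ *≡* (trans (cong (ℤ._* + 1) (ℤP.pos-+ a b)) (lemma (+ a) (+ b))) ⟩
    mkℚᵘ (+ a) 0 ℚᵘ.+ mkℚᵘ (+ b) 0       ≡⟨ cong₂ ℚᵘ._+_ (toℚᵘ-ℕ→ℚ a) (toℚᵘ-ℕ→ℚ b) ⟨
    toℚᵘ (ℕ→ℚ a) ℚᵘ.+ toℚᵘ (ℕ→ℚ b)       ≈⟨ ℚP.toℚᵘ-homo-+ (ℕ→ℚ a) (ℕ→ℚ b) ⟨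
    toℚᵘ (ℕ→ℚ a + ℕ→ℚ b)                 ∎)
    where
    open import Relation.Binary.Reasoning.Setoid ℚᵘP.≃-setoid
    lemma : ∀ x y → (x ℤ.+ y) ℤ.* + 1 ≡ (x ℤ.* + 1 ℤ.+ y ℤ.* + 1) ℤ.* + 1
    lemma = ℤ-solve

  ℕ→ℚ-* : ∀ a b → ℕ→ℚ (a ℕ.* b) ≡ ℕ→ℚ a * ℕ→ℚ b
  ℕ→ℚ-* a b = ℚP.toℚᵘ-injective (begin
    toℚᵘ (ℕ→ℚ (a ℕ.* b))                 ≡⟨ toℚᵘ-ℕ→ℚ (a ℕ.* b) ⟩
    mkℚᵘ (+ (a ℕ.* b)) 0                 ≈⟨ *≡* (cong (ℤ._* + 1) (ℤP.pos-* a b)) ⟩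
    mkℚᵘ (+ a) 0 ℚᵘ.* mkℚᵘ (+ b) 0       ≡⟨ cong₂ ℚᵘ._*_ (toℚᵘ-ℕ→ℚ a) (toℚᵘ-ℕ→ℚ b) ⟨
    toℚᵘ (ℕ→ℚ a) ℚᵘ.* toℚᵘ (ℕ→ℚ b)       ≈⟨ ℚP.toℚᵘ-homo-* (ℕ→ℚ a) (ℕ→ℚ b) ⟨
    toℚᵘ (ℕ→ℚ a * ℕ→ℚ b)                 ∎)
    where open import Relation.Binary.Reasoning.Setoid ℚᵘP.≃-setoid

  ℕ→ℚ-mono-≤ : ∀ {a b} → a ℕ.≤ b → ℕ→ℚ a ≤ ℕ→ℚ b
  ℕ→ℚ-mono-≤ {a} {b} a≤b = ℚP.toℚᵘ-cancel-≤ (subst₂ ℚᵘ._≤_ (sym (toℚᵘ-ℕ→ℚ a)) (sym (toℚᵘ-ℕ→ℚ b))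
    (*≤* (subst₂ ℤ._≤_ (sym (ℤP.*-identityʳ (+ a))) (sym (ℤP.*-identityʳ (+ b))) (ℤ.+≤+ a≤b))))

  ℕ→ℚ-nonNeg : ∀ a → NonNegative (ℕ→ℚ a)
  ℕ→ℚ-nonNeg a = subst NonNegative (sym (ℕ→ℚ-coprime a)) _

  ℕ→ℚ-pos : ∀ a → Positive (ℕ→ℚ (suc a))
  ℕ→ℚ-pos a = subst Positive (sym (ℕ→ℚ-coprime (suc a))) _

  [ℓ/1+ℓ]*[1+ℓ] : ∀ ℓ → (+ ℓ / suc ℓ) * ℕ→ℚ (suc ℓ) ≡ ℕ→ℚ ℓ
  [ℓ/1+ℓ]*[1+ℓ] ℓ = ℚP.toℚᵘ-injective (begin
    toℚᵘ ((+ ℓ / suc ℓ) * ℕ→ℚ (suc ℓ))         ≈⟨ ℚP.toℚᵘ-homo-* (+ ℓ / suc ℓ) (ℕ→ℚ (suc ℓ)) ⟩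
    toℚᵘ (+ ℓ / suc ℓ) ℚᵘ.* toℚᵘ (ℕ→ℚ (suc ℓ))
      ≈⟨ ℚᵘP.*-cong (ℚP.toℚᵘ-fromℚᵘ (mkℚᵘ (+ ℓ) ℓ)) (ℚᵘP.≃-reflexive (toℚᵘ-ℕ→ℚ (suc ℓ))) ⟩
    mkℚᵘ (+ ℓ) ℓ ℚᵘ.* mkℚᵘ (+ suc ℓ) 0
      ≈⟨ *≡* (trans (ℤP.*-identityʳ (+ ℓ ℤ.* + suc ℓ)) (cong (λ k → + ℓ ℤ.* + k) (sym (ℕP.*-identityʳ (suc ℓ))))) ⟩
    mkℚᵘ (+ ℓ) 0                               ≡⟨ toℚᵘ-ℕ→ℚ ℓ ⟨
    toℚᵘ (ℕ→ℚ ℓ)                               ∎)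
    where open import Relation.Binary.Reasoning.Setoid ℚᵘP.≃-setoid

  archimedean : ∀ ε → Positive ε → Σ ℕ λ b → 1ℚ ≤ ε * ℕ→ℚ b
  archimedean ε@(mkℚ (+ suc a) d _) _ = suc d , ℚP.toℚᵘ-cancel-≤ (ℚᵘP.≤-respʳ-≃ (ℚᵘP.≃-sym ε*d≃) 1≤ε*d)
    where
    ε*d≃ : toℚᵘ (ε * ℕ→ℚ (suc d)) ℚᵘ.≃ mkℚᵘ (+ suc a) d ℚᵘ.* mkℚᵘ (+ suc d) 0
    ε*d≃ = ℚᵘP.≃-trans (ℚP.toℚᵘ-homo-* ε (ℕ→ℚ (suc d)))
                       (ℚᵘP.≃-reflexive (cong (mkℚᵘ (+ suc a) d ℚᵘ.*_) (toℚᵘ-ℕ→ℚ (suc d))))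
    1≤ε*d : mkℚᵘ (+ 1) 0 ℚᵘ.≤ mkℚᵘ (+ suc a) d ℚᵘ.* mkℚᵘ (+ suc d) 0
    1≤ε*d = *≤* (subst₂ ℤ._≤_ (sym (ℤP.*-identityˡ (+ (suc d ℕ.* 1))))
                              (trans (sym (ℤP.pos-* (suc a) (suc d))) (sym (ℤP.*-identityʳ (+ suc a ℤ.* + suc d))))
                              (ℤ.+≤+ (ℕP.≤-trans (ℕP.≤-reflexive (ℕP.*-identityʳ (suc d))) (ℕP.m≤n*m (suc d) (suc a)))))

  +-cancelʳ-≤ : ∀ p q r → p + r ≤ q + r → p ≤ q
  +-cancelʳ-≤ p q r p+r≤q+r = subst₂ _≤_ (cancel p) (cancel q) (ℚP.+-monoˡ-≤ (- r) p+r≤q+r)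
    where
    cancel : ∀ x → x + r + - r ≡ x
    cancel x = solve 2 (λ x r → x :+ r :+ (:- r) := x) refl x r

  counting-in-ℚ : ∀ R A B C K E V →
    R ℕ.* A ℕ.* K ℕ.≤ R ℕ.* A ℕ.* E ℕ.+ R ℕ.* B ℕ.* K ℕ.+ A ℕ.* C ℕ.* V →
    ℕ→ℚ R * ℕ→ℚ A * ℕ→ℚ K ≤
    ℕ→ℚ R * ℕ→ℚ A * ℕ→ℚ E + ℕ→ℚ R * ℕ→ℚ B * ℕ→ℚ K + ℕ→ℚ A * ℕ→ℚ C * ℕ→ℚ V
  counting-in-ℚ R A B C K E V counting = subst₂ _≤_ (ℕ→ℚ-*₃ R A K)
    (trans (ℕ→ℚ-+ (R ℕ.* A ℕ.* E ℕ.+ R ℕ.* B ℕ.* K) (A ℕ.* C ℕ.* V))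
           (cong₂ _+_ (trans (ℕ→ℚ-+ (R ℕ.* A ℕ.* E) (R ℕ.* B ℕ.* K)) (cong₂ _+_ (ℕ→ℚ-*₃ R A E) (ℕ→ℚ-*₃ R B K)))
                      (ℕ→ℚ-*₃ A C V)))
    (ℕ→ℚ-mono-≤ counting)
    where
    ℕ→ℚ-*₃ : ∀ x y z → ℕ→ℚ (x ℕ.* y ℕ.* z) ≡ ℕ→ℚ x * ℕ→ℚ y * ℕ→ℚ z
    ℕ→ℚ-*₃ x y z = trans (ℕ→ℚ-* (x ℕ.* y) z) (cong (_* ℕ→ℚ z) (ℕ→ℚ-* x y))

  dense-from-counting : ∀ (d η : ℚ) (R A B C K E V : ℕ) .{{_ : ℕ.NonZero R}} .{{_ : ℕ.NonZero A}} →
    R ℕ.* A ℕ.* K ℕ.≤ R ℕ.* A ℕ.* E ℕ.+ R ℕ.* B ℕ.* K ℕ.+ A ℕ.* C ℕ.* V →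
    d * ℕ→ℚ A + ℕ→ℚ B ≤ ℕ→ℚ A →
    ℕ→ℚ C ≤ η * ℕ→ℚ R →
    d * ℕ→ℚ K ≤ ℕ→ℚ E + η * ℕ→ℚ V
  dense-from-counting d η R@(suc _) A@(suc _) B C K E V counting dA+B≤A C≤ηR =
    ℚP.*-cancelˡ-≤-pos (r * a) (+-cancelʳ-≤ _ _ (r * b * k) (begin
      r * a * (d * k) + r * b * k   ≡⟨ solve 5 (λ r a d k b → r :* a :* (d :* k) :+ r :* b :* k := r :* k :* (d :* a :+ b))
                                              refl r a d k b ⟩
      r * k * (d * a + b)           ≤⟨ ℚP.*-monoˡ-≤-nonNeg (r * k) dA+B≤A ⟩
      r * k * a                     ≡⟨ solve 3 (λ r k a → r :* k :* a := r :* a :* k) refl r k a ⟩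
      r * a * k                     ≤⟨ counting-in-ℚ R A B C K E V counting ⟩
      r * a * e + r * b * k + a * c * v
        ≤⟨ ℚP.+-monoʳ-≤ (r * a * e + r * b * k)
             (subst (_≤ a * v * (η * r)) (solve 3 (λ a c v → a :* v :* c := a :* c :* v) refl a c v)
                    (ℚP.*-monoˡ-≤-nonNeg (a * v) C≤ηR)) ⟩
      r * a * e + r * b * k + a * v * (η * r)
        ≡⟨ solve 7 (λ r a e b k v η → r :* a :* e :+ r :* b :* k :+ a :* v :* (η :* r) := r :* a :* (e :+ η :* v) :+ r :* b :* k)
                   refl r a e b k v η ⟩
      r * a * (e + η * v) + r * b * k ∎))
    where
    open ℚP.≤-Reasoning
    r = ℕ→ℚ R
    a = ℕ→ℚ A
    b = ℕ→ℚ B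
    c = ℕ→ℚ C
    k = ℕ→ℚ K
    e = ℕ→ℚ E
    v = ℕ→ℚ V
    instance
      r*k-nonNeg : NonNegative (r * k)
      r*k-nonNeg = subst NonNegative (ℕ→ℚ-* R K) (ℕ→ℚ-nonNeg (R ℕ.* K))
      a*v-nonNeg : NonNegative (a * v)
      a*v-nonNeg = subst NonNegative (ℕ→ℚ-* A V) (ℕ→ℚ-nonNeg (A ℕ.* V))
      r*a-pos : Positive (r * a)
      r*a-pos = subst Positive (ℕ→ℚ-* R A) (ℕ→ℚ-pos (ℕ.pred (R ℕ.* A)))

  gap-positive : ∀ {d x} → d < x → Positive (x - d)
  gap-positive {d} {x} d<x = ℚ.positive (subst (_< x - d) (solve 1 (λ d → d :- d := con 0ℚ) refl d) (ℚP.+-monoˡ-< (- d) d<x))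

  η-block-exponent : ∀ η → Positive η → ∀ C N₀ → Σ ℕ λ j → N₀ ℕ.≤ j × ℕ→ℚ C ≤ η * ℕ→ℚ (2 ^ j)
  η-block-exponent η η-pos C N₀ with archimedean η η-pos
  ... | b , 1≤ηb = C ℕ.* b ℕ.+ N₀ , ℕP.m≤n+m N₀ (C ℕ.* b) , (begin
    ℕ→ℚ C                 ≡⟨ ℚP.*-identityʳ (ℕ→ℚ C) ⟨
    ℕ→ℚ C * 1ℚ            ≤⟨ ℚP.*-monoˡ-≤-nonNeg (ℕ→ℚ C) 1≤ηb ⟩
    ℕ→ℚ C * (η * ℕ→ℚ b)   ≡⟨ trans (solve 3 (λ c e b → c :* (e :* b) := e :* (c :* b)) refl (ℕ→ℚ C) η (ℕ→ℚ b))
                                   (cong (η *_) (sym (ℕ→ℚ-* C b))) ⟩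
    η * ℕ→ℚ (C ℕ.* b)     ≤⟨ ℚP.*-monoˡ-≤-nonNeg η (ℕ→ℚ-mono-≤ (ℕP.≤-trans (ℕP.m≤m+n (C ℕ.* b) N₀)
                                                                         (n≤2^n _))) ⟩
    η * ℕ→ℚ (2 ^ (C ℕ.* b ℕ.+ N₀)) ∎)
    where
    open ℚP.≤-Reasoning
    instance
      _ = ℚP.pos⇒nonNeg η {{η-pos}}
      _ = ℕ→ℚ-nonNeg C

  colour-exponent : ∀ ℓ d → d < + ℓ / suc ℓ →
    Σ ℕ λ t → 1 ℕ.≤ t × d * ℕ→ℚ (suc ℓ ℕ.* 2 ^ t) + ℕ→ℚ (2 ^ t ℕ.+ suc ℓ) ≤ ℕ→ℚ (suc ℓ ℕ.* 2 ^ t)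
  colour-exponent ℓ d d<L = t , ℕ.s≤s ℕ.z≤n , (begin
    d * ℕ→ℚ (q ℕ.* T) + ℕ→ℚ (T ℕ.+ q)
      ≡⟨ cong₂ (λ u v → d * u + v) (ℕ→ℚ-* q T) (ℕ→ℚ-+ T q) ⟩
    d * (ℕ→ℚ q * ℕ→ℚ T) + (ℕ→ℚ T + ℕ→ℚ q)
      ≡⟨ solve 4 (λ d L q T → d :* (q :* T) :+ (T :+ q) := (L :* q) :* T :+ (T :+ q) :+ (:- (q :* ((L :- d) :* T))))
                 refl d L (ℕ→ℚ q) (ℕ→ℚ T) ⟩
    (L * ℕ→ℚ q) * ℕ→ℚ T + (ℕ→ℚ T + ℕ→ℚ q) - ℕ→ℚ q * ((L - d) * ℕ→ℚ T)
      ≤⟨ ℚP.+-monoʳ-≤ ((L * ℕ→ℚ q) * ℕ→ℚ T + (ℕ→ℚ T + ℕ→ℚ q))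
                      (ℚP.neg-antimono-≤ (ℚP.*-monoˡ-≤-nonNeg (ℕ→ℚ q) 1≤εT)) ⟩
    (L * ℕ→ℚ q) * ℕ→ℚ T + (ℕ→ℚ T + ℕ→ℚ q) - ℕ→ℚ q * 1ℚ
      ≡⟨ cong₂ (λ u v → u * ℕ→ℚ T + (ℕ→ℚ T + v) - v * 1ℚ) ([ℓ/1+ℓ]*[1+ℓ] ℓ) (ℕ→ℚ-+ 1 ℓ) ⟩
    ℕ→ℚ ℓ * ℕ→ℚ T + (ℕ→ℚ T + (1ℚ + ℕ→ℚ ℓ)) - (1ℚ + ℕ→ℚ ℓ) * 1ℚ
      ≡⟨ solve 2 (λ l T → l :* T :+ (T :+ (con 1ℚ :+ l)) :- (con 1ℚ :+ l) :* con 1ℚ := (con 1ℚ :+ l) :* T)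
                 refl (ℕ→ℚ ℓ) (ℕ→ℚ T) ⟩
    (1ℚ + ℕ→ℚ ℓ) * ℕ→ℚ T
      ≡⟨ cong (_* ℕ→ℚ T) (ℕ→ℚ-+ 1 ℓ) ⟨
    ℕ→ℚ q * ℕ→ℚ T
      ≡⟨ ℕ→ℚ-* q T ⟨
    ℕ→ℚ (q ℕ.* T) ∎)
    where
    open ℚP.≤-Reasoning
    L = + ℓ / suc ℓ
    q = suc ℓ
    b = proj₁ (archimedean (L - d) (gap-positive d<L))
    1≤εb = proj₂ (archimedean (L - d) (gap-positive d<L))
    t = suc b
    T = 2 ^ t
    instance
      _ = ℚP.pos⇒nonNeg (L - d) {{gap-positive d<L}}
      _ = ℕ→ℚ-nonNeg q
    1≤εT : 1ℚ ≤ (L - d) * ℕ→ℚ T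
    1≤εT = ℚP.≤-trans 1≤εb (ℚP.*-monoˡ-≤-nonNeg (L - d) (ℕ→ℚ-mono-≤ (ℕP.≤-trans (ℕP.n≤1+n b) (n≤2^n t))))

  below-fraction : ∀ d → d < 1ℚ → Σ ℕ λ ℓ → d < + ℓ / suc ℓ
  below-fraction d d<1 with archimedean (1ℚ - d) (gap-positive d<1)
  ... | ℓ , 1≤εℓ = ℓ , ℚP.*-cancelʳ-<-nonNeg (ℕ→ℚ (suc ℓ)) {{ℕ→ℚ-nonNeg (suc ℓ)}} (begin-strict
    d * ℕ→ℚ (suc ℓ)             ≡⟨ cong (d *_) (ℕ→ℚ-+ 1 ℓ) ⟩
    d * (1ℚ + ℕ→ℚ ℓ)            ≡⟨ solve 2 (λ d l → d :* (con 1ℚ :+ l) := d :+ d :* l) refl d (ℕ→ℚ ℓ) ⟩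
    d + d * ℕ→ℚ ℓ               <⟨ ℚP.+-monoˡ-< (d * ℕ→ℚ ℓ) d<1 ⟩
    1ℚ + d * ℕ→ℚ ℓ              ≤⟨ ℚP.+-monoˡ-≤ (d * ℕ→ℚ ℓ) 1≤εℓ ⟩
    (1ℚ - d) * ℕ→ℚ ℓ + d * ℕ→ℚ ℓ ≡⟨ solve 2 (λ d l → (con 1ℚ :- d) :* l :+ d :* l := l) refl d (ℕ→ℚ ℓ) ⟩
    ℕ→ℚ ℓ                       ≡⟨ [ℓ/1+ℓ]*[1+ℓ] ℓ ⟨
    (+ ℓ / suc ℓ) * ℕ→ℚ (suc ℓ) ∎)
    where open ℚP.≤-Reasoning

module Ramsey where

  open ℕΣ
  open import Data.Nat.Base using (_+_; _*_; _≤_)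

  merge-into-zero : ∀ {r} → Fin (suc (suc r)) → Fin (suc (suc r)) → Fin (suc r)
  merge-into-zero γ x with x Finₚ.≟ γ
  ... | yes _   = zero
  ... | no  x≢γ = punchOut (x≢γ ∘ sym)

  merge-into-zero-injective : ∀ {r} (γ x y : Fin (suc (suc r))) → x ≢ γ → y ≢ γ →
                              merge-into-zero γ x ≡ merge-into-zero γ y → x ≡ y
  merge-into-zero-injective γ x y x≢γ y≢γ e with x Finₚ.≟ γ | y Finₚ.≟ γ
  ... | yes x≡γ | _       = ⊥-elim (x≢γ x≡γ)
  ... | no  _   | yes y≡γ = ⊥-elim (y≢γ y≡γ)
  ... | no  p   | no  q   = Finₚ.punchOut-injective (λ e → p (sym e)) (λ e → q (sym e)) e

  ramsey-bound : ℕ → ℕ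
  ramsey-bound zero    = 3
  ramsey-bound (suc r) = suc (suc (suc r) * ramsey-bound r)

  pigeonhole-sum : ∀ q k (g : Fin (suc q) → ℕ) → suc q * k ≤ sum g → ∃ λ γ → k ≤ g γ
  pigeonhole-sum zero    k g k≤g₀ = zero , subst₂ _≤_ (ℕP.+-identityʳ k) (ℕP.+-identityʳ (g zero)) k≤g₀
  pigeonhole-sum (suc q) k g q′k≤∑g with k ℕP.≤? g zero
  ... | yes k≤g₀ = zero , k≤g₀
  ... | no  k≰g₀ = let γ , k≤gγ = pigeonhole-sum q k (λ γ → g (suc γ)) rest in suc γ , k≤gγ
    where
    rest : suc q * k ≤ sum (λ γ → g (suc γ))
    rest = ℕP.+-cancelˡ-≤ (g zero) _ _ (ℕP.≤-trans (ℕP.+-monoˡ-≤ (suc q * k) (ℕP.<⇒≤ (ℕP.≰⇒> k≰g₀))) q′k≤∑g)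

  Fin1-irrelevant : (x y : Fin 1) → x ≡ y
  Fin1-irrelevant zero zero = refl

  module _ {V : Set} (_≟_ : DecidableEquality V) where

    Symmetric : ∀ {r} → (V → V → Fin r) → Set
    Symmetric c = ∀ a b → a ≢ b → c a b ≡ c b a

    Triangle : ∀ {r} → (V → V → Fin r) → List V → Set
    Triangle c L = Σ V λ a → Σ V λ b → Σ V λ d → a ∈ L × b ∈ L × d ∈ L ×
      a ≢ b × a ≢ d × b ≢ d × c a b ≡ c a d × c a b ≡ c b d

    colour-class : ∀ {q} → (V → Fin q) → Fin q → List V → List V
    colour-class f γ = filter (λ u → f u Finₚ.≟ γ)

    ∑-colour-class : ∀ q (f : V → Fin q) (L : List V) → ∑[ γ < q ] length (colour-class f γ L) ≡ length L
    ∑-colour-class q f []      = sum-replicate-zero q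
    ∑-colour-class q f (w ∷ L) = begin
      ∑[ γ < q ] length (colour-class f γ (w ∷ L))
        ≡⟨ sum-cong-≗ {q} (λ γ → length-step γ) ⟩
      ∑[ γ < q ] ([ does (f w Finₚ.≟ γ) ] + length (colour-class f γ L))
        ≡⟨ ∑-distrib-+ (λ γ → [ does (f w Finₚ.≟ γ) ]) (λ γ → length (colour-class f γ L)) ⟩
      ∑[ γ < q ] [ does (f w Finₚ.≟ γ) ] + ∑[ γ < q ] length (colour-class f γ L)
        ≡⟨ cong₂ _+_ (∑-δ (f w)) (∑-colour-class q f L) ⟩
      suc (length L) ∎
      where
      open ≡-Reasoning
      length-step : ∀ γ → length (colour-class f γ (w ∷ L)) ≡ [ does (f w Finₚ.≟ γ) ] + length (colour-class f γ L)
      length-step γ with does (f w Finₚ.≟ γ)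
      ... | true  = refl
      ... | false = refl

    module Neighbourhood {r} (c : V → V → Fin (suc (suc r))) (v : V) (L : List V) (v∉L : All (v ≢_) L) (γ : Fin (suc (suc r))) where

      neighbours = colour-class (c v) γ L

      merged : V → V → Fin (suc r)
      merged a b = merge-into-zero γ (c a b)

      neighbour : ∀ {a} → a ∈ neighbours → a ∈ L × c v a ≡ γ
      neighbour = Membershipₚ.∈-filter⁻ (λ u → c v u Finₚ.≟ γ)

      v≢ : ∀ {a} → a ∈ L → v ≢ a
      v≢ = go v∉L
        where
        go : ∀ {M} → All (v ≢_) M → ∀ {a} → a ∈ M → v ≢ a
        go (v≢a ∷ _)   (here refl) = v≢a
        go (_ ∷ v∉M) (there a∈M) = go v∉M a∈M

      triangle-through-v : ∀ {a b} → a ∈ neighbours → b ∈ neighbours → a ≢ b → c a b ≡ γ → Triangle c (v ∷ L)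
      triangle-through-v a∈ b∈ a≢b ab≡γ =
        v , _ , _ , here refl , there (proj₁ (neighbour a∈)) , there (proj₁ (neighbour b∈)) ,
        v≢ (proj₁ (neighbour a∈)) , v≢ (proj₁ (neighbour b∈)) , a≢b ,
        trans (proj₂ (neighbour a∈)) (sym (proj₂ (neighbour b∈))) , trans (proj₂ (neighbour a∈)) (sym ab≡γ)

      lift : Triangle merged neighbours → Triangle c (v ∷ L)
      lift (a , b , d , a∈ , b∈ , d∈ , a≢b , a≢d , b≢d , ab≡ad , ab≡bd) =
        by-cases (c a b Finₚ.≟ γ) (c a d Finₚ.≟ γ) (c b d Finₚ.≟ γ)
        where
        by-cases : Dec (c a b ≡ γ) → Dec (c a d ≡ γ) → Dec (c b d ≡ γ) → Triangle c (v ∷ L)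
        by-cases (yes ab≡γ) _          _          = triangle-through-v a∈ b∈ a≢b ab≡γ
        by-cases (no  _)    (yes ad≡γ) _          = triangle-through-v a∈ d∈ a≢d ad≡γ
        by-cases (no  _)    (no  _)    (yes bd≡γ) = triangle-through-v b∈ d∈ b≢d bd≡γ
        by-cases (no  ab≢γ) (no  ad≢γ) (no  bd≢γ) =
          a , b , d , there (proj₁ (neighbour a∈)) , there (proj₁ (neighbour b∈)) , there (proj₁ (neighbour d∈)) ,
          a≢b , a≢d , b≢d ,
          merge-into-zero-injective γ _ _ ab≢γ ad≢γ ab≡ad , merge-into-zero-injective γ _ _ ab≢γ bd≢γ ab≡bd

    triangle : ∀ r (c : V → V → Fin (suc r)) → Symmetric c → (L : List V) → Unique L →
               ramsey-bound r ≤ length L → Triangle c L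
    triangle zero c _ (a ∷ b ∷ d ∷ L) ((a≢b ∷ a≢d ∷ _) ∷ (b≢d ∷ _) ∷ _) _ =
      a , b , d , here refl , there (here refl) , there (there (here refl)) , a≢b , a≢d , b≢d ,
      Fin1-irrelevant _ _ , Fin1-irrelevant _ _
    triangle zero c _ []          _ ()
    triangle zero c _ (_ ∷ [])     _ (s≤s ())
    triangle zero c _ (_ ∷ _ ∷ []) _ (s≤s (s≤s ()))
    triangle (suc r) c c-sym (v ∷ L) (v∉L ∷ L-unique) (s≤s bound≤L) =
      lift (triangle r merged merged-sym neighbours (Uniqueₚ.filter⁺ (λ u → c v u Finₚ.≟ γ) L-unique) large-class)
      where
      class-sizes = λ γ → length (colour-class (c v) γ L)
      majority = pigeonhole-sum (suc r) (ramsey-bound r) class-sizes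
                   (subst (suc (suc r) * ramsey-bound r ≤_) (sym (∑-colour-class (suc (suc r)) (c v) L)) bound≤L)
      γ = proj₁ majority
      large-class = proj₂ majority
      open Neighbourhood c v L v∉L γ
      merged-sym : Symmetric merged
      merged-sym a b a≢b = cong (merge-into-zero γ) (c-sym a b a≢b)

  ramsey : ∀ r → ∃ λ k → Arrows (suc r) k
  ramsey r = ramsey-bound r , λ c →
    let a , b , d , _ , _ , _ , rest = triangle Finₚ._≟_ r (Colouring.col c) (Colouring.sym c) (allFin (ramsey-bound r))
                                                (Uniqueₚ.allFin⁺ (ramsey-bound r))
                                                (ℕP.≤-reflexive (sym (Listₚ.length-tabulate (λ i → i))))
    in a , b , d , rest

open Ramsey using (ramsey)
open RationalArithmetic using (dense-from-counting; colour-exponent; η-block-exponent; below-fraction)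

admissible : ∀ ℓ {k₀ k} → Arrows (suc ℓ) k₀ → k₀ ℕ.≤ k → ∀ d → d < + ℓ / suc ℓ → AdmissibleEE k d
admissible ℓ arrows k₀≤k d d<L η 0<η N₀ =
  n , N₀≤n , hypergraph , clique-free arrows k₀≤k ,
  λ P Q → dense-from-counting d η R (q ℕ.* 2 ^ t) (2 ^ t ℕ.+ q) (3 ℕ.+ 2 ^ t ℕ.+ q)
                              (sizeK P Q) (ePQ hypergraph P Q) (n ^ 3)
            {{ℕP.m^n≢0 2 j}} {{ℕP.m*n≢0 q (2 ^ t) {{_}} {{ℕP.m^n≢0 2 t}}}}
            (counting-inequality N≡R² R≤n P Q) dA+B≤A C≤ηR
  where
  q = suc ℓ
  t = proj₁ (colour-exponent ℓ d d<L)
  1≤t = proj₁ (proj₂ (colour-exponent ℓ d d<L))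
  dA+B≤A = proj₂ (proj₂ (colour-exponent ℓ d d<L))
  block = η-block-exponent η (ℚ.positive 0<η) (3 ℕ.+ 2 ^ t ℕ.+ q) N₀
  j = proj₁ block
  N₀≤j = proj₁ (proj₂ block)
  C≤ηR = proj₂ (proj₂ block)
  R = 2 ^ j
  open Construction (j ℕ.+ j) t q
  open Density (j ℕ.+ j) t q R
  N≡R² : N ≡ R ℕ.* R
  N≡R² = ℕP.^-distribˡ-+-* 2 j j
  R≤n : R ℕ.≤ n
  R≤n = ℕP.≤-trans (ℕP.m≤m*n R R {{ℕP.m^n≢0 2 j}})
          (ℕP.≤-trans (ℕP.≤-reflexive (sym N≡R²))
            (ℕP.≤-trans (ℕP.≤-reflexive (sym (ℕP.*-identityʳ N))) (ℕP.^-monoʳ-≤ N {{ℕP.m^n≢0 2 (j ℕ.+ j)}} 1≤t)))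
  N₀≤n : N₀ ℕ.≤ n
  N₀≤n = ℕP.≤-trans N₀≤j (ℕP.≤-trans (n≤2^n j) R≤n)

mainTheorem5 : (∀ (ℓ : ℕ) (k : ℕ) → IsR3 (suc ℓ) k → πee≥ k (+ ℓ / suc ℓ))
    × (∀ (d : ℚ) → d < 1ℚ → Σ ℕ λ K → ∀ k → k ≥ K → πee≥ k d)
mainTheorem5 = (λ ℓ k R3 d _ _ d<L → admissible ℓ (proj₁ R3) ℕP.≤-refl d d<L)
             , λ d d<1 → let ℓ , d<L = below-fraction d d<1 ; k₀ , arrows = ramsey ℓ in
                 k₀ , λ k k₀≤k d′ _ _ d′<d → admissible ℓ arrows k₀≤k d′ (ℚP.<-trans d′<d d<L)
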